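{- Let $S(t,p,q)=\sum_{\pi}t^{|\pi|}p^{\mathrm{asc}(\pi)}q^{\mathrm{des}(\pi)}$, summed over all separable permutations, and let $I(t,p,q)$ be the same sum restricted to irreducible separable permutations. Then $$pq\,S(t,p,q)^3+pq\,t\,S(t,p,q)^2+S(t,p,q)\big((p+q)t-1\big)+t=0,$$ and $$I(t,p,q)=\frac{t+q\,(t+S(t,p,q))\,S(t,p,q)}{1+q\,S(t,p,q)}.$$
   Context: A permutation of length $n$ is a word $\pi=\pi_1\cdots\pi_n$ rearranging $\{1,\dots,n\}$; $|\pi|=n$. For $\pi\in S_m,\sigma\in S_n$: $\pi\oplus\sigma=\pi_1\cdots\pi_m(\sigma_1+m)\cdots(\sigma_n+m)$, $\pi\ominus\sigma=(\pi_1+n)\cdots(\pi_m+n)\sigma_1\cdots\sigma_n$. Separable permutations are those obtainable from $1$ by repeatedly applying $\oplus$ and $\ominus$ (equivalently, nonempty permutations avoiding $2413$ and $3142$). A permutation $\pi_1\cdots\pi_n$ with $n\ge2$ is irreducible if there is no $i$ with $2\le i\le n$ such that every element of $\pi_1\cdots\pi_{i-1}$ is smaller than every element of $\pi_i\cdots\pi_n$; the permutation $1$ is irreducible. $\mathrm{des}(\pi)$ (resp. $\mathrm{asc}(\pi)$) is the number of $i\in\{1,\dots,n-1\}$ with $\pi_i>\pi_{i+1}$ (resp. $\pi_i<\pi_{i+1}$). -}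

module Defs where

open import Data.Nat as ℕ using (ℕ; zero; suc; _∸_; _<ᵇ_; _≡ᵇ_)
open import Data.Bool using (Bool; true; false; _∧_; _∨_; not; if_then_else_)
open import Data.List using (List; []; _∷_; _++_; map; concatMap; length; take; drop; upTo)
open import Data.Bool.ListAction using (any; all)
open import Data.List.Properties using (≡-dec)
open import Relation.Nullary.Decidable using (⌊_⌋)
open import Data.Integer as ℤ using (ℤ)
open import Relation.Binary.PropositionalEquality using (_≡_)

-- Permutations as words  π₁ ⋯ πₙ  over {1,…,n}

inserts : ℕ → List ℕ → List (List ℕ)
inserts x []       = (x ∷ []) ∷ []
inserts x (y ∷ ys) = (x ∷ y ∷ ys) ∷ map (y ∷_) (inserts x ys)

perms : ℕ → List (List ℕ)
perms zero    = [] ∷ []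
perms (suc n) = concatMap (inserts (suc n)) (perms n)

infixl 6 _⊕_ _⊖_
_⊕_ : List ℕ → List ℕ → List ℕ
π ⊕ σ = π ++ map (ℕ._+ length π) σ

_⊖_ : List ℕ → List ℕ → List ℕ
π ⊖ σ = map (ℕ._+ length σ) π ++ σ

_==_ : List ℕ → List ℕ → Bool
u == v = ⌊ ≡-dec ℕ._≟_ u v ⌋

splits : List ℕ → List ℕ
splits w = map suc (upTo (length w ∸ 1))

-- Separable (with fuel, recursion on length): w is separable iff
-- w = 1, or w = π ⊕ σ or w = π ⊖ σ for nonempty separable π, σ.
-- For a split point i, the only candidates are
--   ⊕ : π = w₁⋯wᵢ,            σ = (wᵢ₊₁ - i)⋯(wₙ - i)
--   ⊖ : π = (w₁-(n-i))⋯(wᵢ-(n-i)), σ = wᵢ₊₁⋯wₙ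
-- and we check that w really equals π ⊕ σ (resp. π ⊖ σ).
sepF : ℕ → List ℕ → Bool
sepF zero    w = false
sepF (suc k) w =
  (w == (1 ∷ [])) ∨
  any (λ i →
        let π₁ = take i w
            σ₁ = map (_∸ i) (drop i w)
            π₂ = map (_∸ (length w ∸ i)) (take i w)
            σ₂ = drop i w
        in ((w == (π₁ ⊕ σ₁)) ∧ sepF k π₁ ∧ sepF k σ₁)
         ∨ ((w == (π₂ ⊖ σ₂)) ∧ sepF k π₂ ∧ sepF k σ₂))
      (splits w)

isSeparable : List ℕ → Bool
isSeparable w = sepF (length w) w

-- Irreducible: no i with 2 ≤ i ≤ n such that every element of
-- π₁⋯π_{i-1} is smaller than every element of πᵢ⋯πₙ  (j = i - 1 below).
-- (For the permutation 1 there is no such i, so it is irreducible.)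
isIrreducible : List ℕ → Bool
isIrreducible w =
  not (any (λ j → all (λ x → all (λ y → x <ᵇ y) (drop j w)) (take j w))
           (splits w))

des : List ℕ → ℕ
des []           = 0
des (x ∷ [])     = 0
des (x ∷ y ∷ ys) = (if y <ᵇ x then 1 else 0) ℕ.+ des (y ∷ ys)

asc : List ℕ → ℕ
asc []           = 0
asc (x ∷ [])     = 0
asc (x ∷ y ∷ ys) = (if x <ᵇ y then 1 else 0) ℕ.+ asc (y ∷ ys)

-- Formal power series in t, p, q with integer coefficients:
-- F n a d = coefficient of t^n p^a q^d.

Series : Set
Series = ℕ → ℕ → ℕ → ℤ

infix 4 _≈_
_≈_ : Series → Series → Set
F ≈ G = ∀ n a d → F n a d ≡ G n a d

infixl 6 _+ₛ_ _-ₛ_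
infixl 7 _*ₛ_

_+ₛ_ : Series → Series → Series
(F +ₛ G) n a d = F n a d ℤ.+ G n a d

_-ₛ_ : Series → Series → Series
(F -ₛ G) n a d = F n a d ℤ.- G n a d

Σ≤ : ℕ → (ℕ → ℤ) → ℤ
Σ≤ zero    f = f zero
Σ≤ (suc n) f = Σ≤ n f ℤ.+ f (suc n)

_*ₛ_ : Series → Series → Series
(F *ₛ G) n a d =
  Σ≤ n λ i → Σ≤ a λ j → Σ≤ d λ k →
    F i j k ℤ.* G (n ∸ i) (a ∸ j) (d ∸ k)

mono : ℕ → ℕ → ℕ → Series
mono i j k n a d = if (n ≡ᵇ i) ∧ (a ≡ᵇ j) ∧ (d ≡ᵇ k) then ℤ.1ℤ else ℤ.0ℤ

0ₛ 1ₛ tₛ pₛ qₛ : Series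
0ₛ = mono 0 0 0 -ₛ mono 0 0 0
1ₛ = mono 0 0 0
tₛ = mono 1 0 0
pₛ = mono 0 1 0
qₛ = mono 0 0 1

countB : {A : Set} → (A → Bool) → List A → ℕ
countB P []       = 0
countB P (x ∷ xs) = (if P x then 1 else 0) ℕ.+ countB P xs

genFun : (List ℕ → Bool) → Series
genFun P n a d = ℤ.+ countB (λ π → P π ∧ (asc π ≡ᵇ a) ∧ (des π ≡ᵇ d)) (perms n)

S : Series
S = genFun isSeparable

I : Series
I = genFun (λ π → isSeparable π ∧ isIrreducible π)

{-# OPTIONS --safe #-}

-- A separable permutation other than 1 is a direct sum or a skew sum, and never both: direct
-- sums are reducible and skew sums irreducible.  Let R = S − I count the reducible ones.  Each
-- of them is α ⊕ β for a unique irreducible separable α and separable β, and the junction of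
-- α ⊕ β is an ascent, so R = p I S.  Reversal exchanges ⊕ with ⊖ and ascents with descents,
-- i.e. p with q.  So the irreducible ones other than 1, being the reverses of reducible ones,
-- are counted by the mirror image B = q J S of R, where J, the mirror image of I, counts the
-- separable permutations with irreducible reverse; mirroring I = t + B gives J = t + R.
-- Eliminating I, R, B and J from S = I + R, R = p I S, I = t + B, B = q J S and J = t + R
-- yields both identities.

module Submission where

open import Algebra.Bundles using (CommutativeSemiring; CommutativeRing)
import Algebra.Construct.Pointwise as Pointwise
import Algebra.Properties.CommutativeSemigroup as CommutativeSemigroupProperties
import Algebra.Properties.Ring as RingProperties
import Algebra.Solver.Ring.NaturalCoefficients.Default as NaturalCoefficientsSolver
open import Data.Nat as ℕ using (ℕ; zero; suc; _∸_; _≤_; z≤n; s≤s; _≟_)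
import Data.Nat.Properties as ℕ
open import Data.Nat.Properties
  using (≤-refl; ≤-pred; ≤∧≢⇒<; <⇒≢; m≤n⇒m≤1+n; n∸n≡0; +-∸-assoc; m+[n∸m]≡n; m+n∸m≡n; ∸-+-assoc; m∸[m∸n]≡n)
open import Data.Product using (_×_; _,_; ∃; ∃₂; proj₁; proj₂)
open import Function using (_∘_; _⇔_; mk⇔; Equivalence)
import Relation.Binary.PropositionalEquality as ≡
open ≡ using (_≡_; _≢_)
open import Relation.Nullary using (¬_; yes; no; contradiction)

-- Finite sums and formal power series

module FiniteSum {c ℓ} (R : CommutativeSemiring c ℓ) where
  open CommutativeSemiring R hiding (zero)
  open import Relation.Binary.Reasoning.Setoid setoid
  open CommutativeSemigroupProperties +-commutativeSemigroup using (interchange)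

  -- The upper bound is included, as in Σ≤.
  ∑ : ℕ → (ℕ → Carrier) → Carrier
  ∑ zero    f = f zero
  ∑ (suc n) f = ∑ n f + f (suc n)

  ∑-cong : ∀ n {f g} → (∀ {i} → i ≤ n → f i ≈ g i) → ∑ n f ≈ ∑ n g
  ∑-cong zero    f≈g = f≈g z≤n
  ∑-cong (suc n) f≈g = +-cong (∑-cong n (f≈g ∘ m≤n⇒m≤1+n)) (f≈g ≤-refl)

  ∑-distrib-+ : ∀ n f g → ∑ n (λ i → f i + g i) ≈ ∑ n f + ∑ n g
  ∑-distrib-+ zero    f g = refl
  ∑-distrib-+ (suc n) f g = trans (+-congʳ (∑-distrib-+ n f g)) (interchange _ _ _ _)

  *-distribˡ-∑ : ∀ n x f → x * ∑ n f ≈ ∑ n (λ i → x * f i)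
  *-distribˡ-∑ zero    x f = refl
  *-distribˡ-∑ (suc n) x f = trans (distribˡ x _ _) (+-congʳ (*-distribˡ-∑ n x f))

  *-distribʳ-∑ : ∀ n x f → ∑ n f * x ≈ ∑ n (λ i → f i * x)
  *-distribʳ-∑ zero    x f = refl
  *-distribʳ-∑ (suc n) x f = trans (distribʳ x _ _) (+-congʳ (*-distribʳ-∑ n x f))

  ∑-zero : ∀ n {f} → (∀ {i} → i ≤ n → f i ≈ 0#) → ∑ n f ≈ 0#
  ∑-zero zero    f≈0 = f≈0 z≤n
  ∑-zero (suc n) f≈0 = trans (+-cong (∑-zero n (f≈0 ∘ m≤n⇒m≤1+n)) (f≈0 ≤-refl)) (+-identityˡ 0#)

  ∑-suc : ∀ n f → ∑ (suc n) f ≈ f 0 + ∑ n (f ∘ suc)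
  ∑-suc zero    f = refl
  ∑-suc (suc n) f = trans (+-congʳ (∑-suc n f)) (+-assoc _ _ _)

  ∑-comm : ∀ m n (f : ℕ → ℕ → Carrier) → ∑ m (λ i → ∑ n (f i)) ≈ ∑ n (λ j → ∑ m (λ i → f i j))
  ∑-comm zero    n f = refl
  ∑-comm (suc m) n f = trans (+-congʳ (∑-comm m n f)) (sym (∑-distrib-+ n _ _))

  ∑-reverse : ∀ n f → ∑ n f ≈ ∑ n (λ i → f (n ∸ i))
  ∑-reverse zero    f = refl
  ∑-reverse (suc n) f = begin
    ∑ n f + f (suc n)                  ≈⟨ +-congʳ (∑-reverse n f) ⟩
    ∑ n (λ i → f (n ∸ i)) + f (suc n)  ≈⟨ +-comm _ _ ⟩
    f (suc n) + ∑ n (λ i → f (n ∸ i))  ≈⟨ sym (∑-suc n _) ⟩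
    ∑ (suc n) (λ i → f (suc n ∸ i))    ∎

  ∑-triangle : ∀ n (f : ℕ → ℕ → Carrier) →
               ∑ n (λ i → ∑ i (λ j → f j i)) ≈ ∑ n (λ j → ∑ (n ∸ j) (λ k → f j (j ℕ.+ k)))
  ∑-triangle zero    f = refl
  ∑-triangle (suc n) f = begin
    ∑ n (λ i → ∑ i (λ j → f j i)) + (∑ n (λ j → f j (suc n)) + f (suc n) (suc n))
      ≈⟨ +-congʳ (∑-triangle n f) ⟩
    ∑ n (λ j → ∑ (n ∸ j) (λ k → f j (j ℕ.+ k))) + (∑ n (λ j → f j (suc n)) + f (suc n) (suc n))
      ≈⟨ sym (+-assoc _ _ _) ⟩
    ∑ n (λ j → ∑ (n ∸ j) (λ k → f j (j ℕ.+ k))) + ∑ n (λ j → f j (suc n)) + f (suc n) (suc n)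
      ≈⟨ +-cong (trans (sym (∑-distrib-+ n _ _)) (∑-cong n extend))
                (reflexive (≡.cong (f (suc n)) (≡.sym (ℕ.+-identityʳ _)))) ⟩
    ∑ n (λ j → ∑ (suc n ∸ j) (λ k → f j (j ℕ.+ k))) + f (suc n) (suc n ℕ.+ 0)
      ≈⟨ +-congˡ (reflexive (≡.cong (λ m → ∑ m (λ k → f (suc n) (suc n ℕ.+ k))) (≡.sym (n∸n≡0 n)))) ⟩
    ∑ (suc n) (λ j → ∑ (suc n ∸ j) (λ k → f j (j ℕ.+ k))) ∎
    where
    extend : ∀ {j} → j ≤ n → ∑ (n ∸ j) (λ k → f j (j ℕ.+ k)) + f j (suc n) ≈ ∑ (suc n ∸ j) (λ k → f j (j ℕ.+ k))
    extend {j} j≤n rewrite +-∸-assoc 1 j≤n =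
      +-congˡ (reflexive (≡.cong (f j) (≡.sym (≡.trans (ℕ.+-suc j (n ∸ j)) (≡.cong suc (m+[n∸m]≡n j≤n))))))

  ∑-single : ∀ n {i₀ f} → i₀ ≤ n → (∀ {i} → i ≤ n → i ≢ i₀ → f i ≈ 0#) → ∑ n f ≈ f i₀
  ∑-single zero    {zero} z≤n    _   = refl
  ∑-single (suc n) {i₀}   i₀≤1+n f≈0 with i₀ ≟ suc n
  ... | yes ≡.refl = trans (+-congʳ (∑-zero n (λ i≤n → f≈0 (m≤n⇒m≤1+n i≤n) (<⇒≢ (s≤s i≤n))))) (+-identityˡ _)
  ... | no  i₀≢  = trans (+-cong (∑-single n (≤-pred (≤∧≢⇒< i₀≤1+n i₀≢)) (f≈0 ∘ m≤n⇒m≤1+n))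
                                 (f≈0 ≤-refl (i₀≢ ∘ ≡.sym)))
                         (+-identityʳ _)

module PowerSeries {c ℓ} (R : CommutativeRing c ℓ) where
  open CommutativeRing R hiding (zero)
  open FiniteSum commutativeSemiring
  open import Relation.Binary.Reasoning.Setoid setoid

  infix 4 _≋_
  _≋_ : (ℕ → Carrier) → (ℕ → Carrier) → Set ℓ
  f ≋ g = ∀ n → f n ≈ g n

  infixl 7 _⋆_
  _⋆_ : (ℕ → Carrier) → (ℕ → Carrier) → ℕ → Carrier
  (f ⋆ g) n = ∑ n λ i → f i * g (n ∸ i)

  𝟏 : ℕ → Carrier
  𝟏 zero    = 1#
  𝟏 (suc n) = 0#

  ⋆-cong : ∀ {f f′ g g′} → f ≋ f′ → g ≋ g′ → f ⋆ g ≋ f′ ⋆ g′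
  ⋆-cong f≋f′ g≋g′ n = ∑-cong n (λ {i} _ → *-cong (f≋f′ i) (g≋g′ (n ∸ i)))

  ⋆-comm : ∀ f g → f ⋆ g ≋ g ⋆ f
  ⋆-comm f g n = trans (∑-reverse n _) (∑-cong n λ {i} i≤n →
    trans (*-comm _ _) (*-congʳ (reflexive (≡.cong g (m∸[m∸n]≡n i≤n)))))

  ⋆-identityˡ : ∀ f → 𝟏 ⋆ f ≋ f
  ⋆-identityˡ f zero    = *-identityˡ (f 0)
  ⋆-identityˡ f (suc n) = begin
    (𝟏 ⋆ f) (suc n)                            ≈⟨ ∑-suc n _ ⟩
    1# * f (suc n) + ∑ n (λ i → 0# * f (n ∸ i)) ≈⟨ +-cong (*-identityˡ _) (∑-zero n (λ _ → zeroˡ _)) ⟩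
    f (suc n) + 0#                             ≈⟨ +-identityʳ _ ⟩
    f (suc n)                                  ∎

  ⋆-assoc : ∀ f g h → (f ⋆ g) ⋆ h ≋ f ⋆ (g ⋆ h)
  ⋆-assoc f g h n = begin
    ∑ n (λ i → ∑ i (λ j → f j * g (i ∸ j)) * h (n ∸ i))
      ≈⟨ ∑-cong n (λ {i} _ → *-distribʳ-∑ i _ _) ⟩
    ∑ n (λ i → ∑ i (λ j → f j * g (i ∸ j) * h (n ∸ i)))
      ≈⟨ ∑-triangle n (λ j i → f j * g (i ∸ j) * h (n ∸ i)) ⟩
    ∑ n (λ j → ∑ (n ∸ j) (λ k → f j * g (j ℕ.+ k ∸ j) * h (n ∸ (j ℕ.+ k))))
      ≈⟨ ∑-cong n (λ {j} _ → ∑-cong (n ∸ j) (λ {k} _ → trans (*-assoc _ _ _) (*-congˡ (*-cong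
           (reflexive (≡.cong g (m+n∸m≡n j k))) (reflexive (≡.cong h (≡.sym (∸-+-assoc n j k)))))))) ⟩
    ∑ n (λ j → ∑ (n ∸ j) (λ k → f j * (g k * h (n ∸ j ∸ k))))
      ≈⟨ ∑-cong n (λ {j} _ → sym (*-distribˡ-∑ (n ∸ j) _ _)) ⟩
    ∑ n (λ j → f j * ∑ (n ∸ j) (λ k → g k * h (n ∸ j ∸ k))) ∎

  ⋆-distribˡ : ∀ f g h → f ⋆ (λ n → g n + h n) ≋ (λ n → (f ⋆ g) n + (f ⋆ h) n)
  ⋆-distribˡ f g h n = trans (∑-cong n (λ _ → distribˡ _ _ _)) (∑-distrib-+ n _ _)

  powerSeriesRing : CommutativeRing c ℓ
  powerSeriesRing = record
    { Carrier = ℕ → Carrier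
    ; _≈_     = _≋_
    ; _+_     = λ f g n → f n + g n
    ; _*_     = _⋆_
    ; -_      = λ f n → - f n
    ; 0#      = λ _ → 0#
    ; 1#      = 𝟏
    ; isCommutativeRing = record
      { isRing = record
        { +-isAbelianGroup = Pointwise.isAbelianGroup ℕ +-isAbelianGroup
        ; *-cong     = ⋆-cong
        ; *-assoc    = ⋆-assoc
        ; *-identity = ⋆-identityˡ , λ f n → trans (⋆-comm f 𝟏 n) (⋆-identityˡ f n)
        ; distrib    = ⋆-distribˡ , λ f g h n → trans (⋆-comm _ f n)
                         (trans (⋆-distribˡ f g h n) (+-cong (⋆-comm f g n) (⋆-comm f h n)))
        }
      ; *-comm = ⋆-comm
      }
    }

  ∑-apply : ∀ n (F : ℕ → ℕ → Carrier) m →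
            FiniteSum.∑ (CommutativeRing.commutativeSemiring powerSeriesRing) n F m ≡ ∑ n (λ i → F i m)
  ∑-apply zero    F m = ≡.refl
  ∑-apply (suc n) F m = ≡.cong (_+ F (suc n) m) (∑-apply n F m)

-- Eliminating the auxiliary series

module Elimination {c ℓ} (𝓡 : CommutativeRing c ℓ) where
  open CommutativeRing 𝓡
  open import Relation.Binary.Reasoning.Setoid setoid
  open RingProperties ring using (-‿distribʳ-*)
  open NaturalCoefficientsSolver commutativeSemiring using (solve; _:=_; _:+_; _:*_; con)

  module FromRelations (S I R B J p q t : Carrier)
    (S≈I+R : S ≈ I + R) (R≈pIS : R ≈ p * I * S) (I≈t+B : I ≈ t + B) (B≈qJS : B ≈ q * J * S) (J≈t+R : J ≈ t + R)
    where

    S≈t+B+R : S ≈ t + B + R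
    S≈t+B+R = trans S≈I+R (+-congʳ I≈t+B)

    R≈p[t+qJS]S : R ≈ p * (t + q * (t + R) * S) * S
    R≈p[t+qJS]S = trans R≈pIS (*-congʳ (*-congˡ (trans I≈t+B (+-congˡ (trans B≈qJS (*-congʳ (*-congˡ J≈t+R)))))))

    B≈q[t+pIS]S : B ≈ q * (t + p * (t + B) * S) * S
    B≈q[t+pIS]S = trans B≈qJS (*-congʳ (*-congˡ (trans J≈t+R (+-congˡ (trans R≈pIS (*-congʳ (*-congˡ I≈t+B)))))))

    S-fixpoint : S ≈ t + p * t * S + q * t * S + p * q * t * S * S + p * q * S * S * S
    S-fixpoint = begin
      S ≈⟨ S≈t+B+R ⟩
      t + B + R ≈⟨ +-cong (+-congˡ B≈q[t+pIS]S) R≈p[t+qJS]S ⟩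
      t + q * (t + p * (t + B) * S) * S + p * (t + q * (t + R) * S) * S
        ≈⟨ solve 6 (λ S t p q R B →
             t :+ q :* (t :+ p :* (t :+ B) :* S) :* S :+ p :* (t :+ q :* (t :+ R) :* S) :* S
             := t :+ p :* t :* S :+ q :* t :* S :+ p :* q :* t :* S :* S :+ p :* q :* S :* S :* (t :+ B :+ R))
           refl S t p q R B ⟩
      t + p * t * S + q * t * S + p * q * t * S * S + p * q * S * S * (t + B + R)
        ≈⟨ +-congˡ (*-congˡ (sym S≈t+B+R)) ⟩
      t + p * t * S + q * t * S + p * q * t * S * S + p * q * S * S * S ∎

    S-cubic : p * q * S * S * S + p * q * t * S * S + S * ((p + q) * t - 1#) + t ≈ 0#
    S-cubic = begin
      p * q * S * S * S + p * q * t * S * S + S * ((p + q) * t + - 1#) + t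
        ≈⟨ solve 7 (λ S t p q m P Q → P :+ Q :+ S :* ((p :+ q) :* t :+ m) :+ t
                                       := (P :+ Q :+ S :* (p :+ q) :* t :+ t) :+ S :* m)
             refl S t p q (- 1#) (p * q * S * S * S) (p * q * t * S * S) ⟩
      (p * q * S * S * S + p * q * t * S * S + S * (p + q) * t + t) + S * - 1#
        ≈⟨ +-cong (solve 4 (λ S t p q →
                     p :* q :* S :* S :* S :+ p :* q :* t :* S :* S :+ S :* (p :+ q) :* t :+ t
                     := t :+ p :* t :* S :+ q :* t :* S :+ p :* q :* t :* S :* S :+ p :* q :* S :* S :* S)
                   refl S t p q)
                  (trans (sym (-‿distribʳ-* S 1#)) (-‿cong (*-identityʳ S))) ⟩
      (t + p * t * S + q * t * S + p * q * t * S * S + p * q * S * S * S) + - S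
        ≈⟨ +-congʳ (sym S-fixpoint) ⟩
      S + - S ≈⟨ -‿inverseʳ S ⟩
      0# ∎

    I-formula : I * (1# + q * S) ≈ t + q * (t + S) * S
    I-formula = begin
      I * (1# + q * S)        ≈⟨ solve 3 (λ I q S → I :* (con 1 :+ q :* S) := I :+ q :* I :* S) refl I q S ⟩
      I + q * I * S           ≈⟨ +-congʳ (trans I≈t+B (+-congˡ B≈qJS)) ⟩
      t + q * J * S + q * I * S ≈⟨ solve 5 (λ t q J S I → t :+ q :* J :* S :+ q :* I :* S := t :+ q :* (J :+ I) :* S)
                                    refl t q J S I ⟩
      t + q * (J + I) * S     ≈⟨ +-congˡ (*-congʳ (*-congˡ (trans (+-congʳ J≈t+R) (trans (+-assoc t R I)
                                   (+-congˡ (trans (+-comm R I) (sym S≈I+R))))))) ⟩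
      t + q * (t + S) * S     ∎

open import Data.Bool using (Bool; true; false; T; not; _∧_; _∨_; if_then_else_)
open import Data.Bool.ListAction using (all)
open import Data.Bool.Properties using (T-≡; T-∧; T-∨; T?; ∧-comm; ∧-zeroʳ)
open import Data.Empty using (⊥; ⊥-elim)
open import Data.Integer as ℤ using (ℤ)
import Data.Integer.Properties as ℤₚ
open import Data.List
  using (List; []; _∷_; _++_; map; length; reverse; filterᵇ; concatMap; cartesianProduct; take; drop)
import Data.List.Properties as List
open import Data.List.Properties using (≡-dec)
open import Data.List.Membership.Propositional using (_∈_; _∉_; find; lose)
import Data.List.Membership.Propositional.Properties as ∈
open import Data.List.Membership.Propositional.Properties.WithK using (unique∧set⇒bag)
open import Data.List.Relation.Unary.Any using (here; there)
import Data.List.Relation.Unary.Any.Properties as Any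
open import Data.List.Relation.Unary.All as All using (All; []; _∷_)
import Data.List.Relation.Unary.All.Properties as All
open import Data.List.Relation.Unary.AllPairs using ([]; _∷_)
open import Data.List.Relation.Unary.Unique.Propositional using (Unique)
import Data.List.Relation.Unary.Unique.Propositional.Properties as Unique
open import Data.List.Relation.Binary.Disjoint.Propositional using (Disjoint)
open import Data.List.Relation.Binary.Permutation.Propositional
  using (_↭_; ↭-refl; ↭-sym; ↭-trans; prep; module PermutationReasoning)
import Data.List.Relation.Binary.Permutation.Propositional.Properties as ↭
open import Data.List.Relation.Binary.BagAndSetEquality using (∼bag⇒↭)
open import Data.Nat using (_+_; _*_; _<_; _<ᵇ_; _≡ᵇ_)
open import Data.Sum using (_⊎_; inj₁; inj₂)
open import Level using (0ℓ)
open import Relation.Nullary.Decidable using (toWitness; decidable-stable)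
open ≡ using (refl; sym; trans; cong; cong₂; subst; module ≡-Reasoning)
open CommutativeSemigroupProperties ℕ.+-commutativeSemigroup using (interchange)

open import Defs

-- Series as a commutative ring

-- The instance used inside PowerSeries, so that PowerSeries.∑-apply speaks about ℤ∑.∑.
module ℤ∑ = FiniteSum (CommutativeRing.commutativeSemiring ℤₚ.+-*-commutativeRing)

module ℕ∑ = FiniteSum ℕ.+-*-commutativeSemiring

-- As F n a d is the coefficient of tⁿ pᵃ qᵈ, Series is ℤ⟦q⟧⟦p⟧⟦t⟧ up to currying, and *ₛ≈* identifies
-- _*ₛ_ with its product; this transports the ring laws to seriesRing.
ℤ⟦q⟧ ℤ⟦q⟧⟦p⟧ ℤ⟦q⟧⟦p⟧⟦t⟧ : CommutativeRing 0ℓ 0ℓ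
ℤ⟦q⟧       = PowerSeries.powerSeriesRing ℤₚ.+-*-commutativeRing
ℤ⟦q⟧⟦p⟧    = PowerSeries.powerSeriesRing ℤ⟦q⟧
ℤ⟦q⟧⟦p⟧⟦t⟧ = PowerSeries.powerSeriesRing ℤ⟦q⟧⟦p⟧

Σ≤≡∑ : ∀ n f → Σ≤ n f ≡ ℤ∑.∑ n f
Σ≤≡∑ zero    f = refl
Σ≤≡∑ (suc n) f = cong (ℤ._+ f (suc n)) (Σ≤≡∑ n f)

module Nested = CommutativeRing ℤ⟦q⟧⟦p⟧⟦t⟧

*ₛ≈* : ∀ F G → F *ₛ G ≈ F Nested.* G
*ₛ≈* F G n a d = trans Σ≤³≡∑³ (sym ∑³≡⋆)
  where
  Σ≤³≡∑³ : Σ≤ n (λ i → Σ≤ a (λ j → Σ≤ d (λ k → F i j k ℤ.* G (n ∸ i) (a ∸ j) (d ∸ k))))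
         ≡ ℤ∑.∑ n (λ i → ℤ∑.∑ a (λ j → ℤ∑.∑ d (λ k → F i j k ℤ.* G (n ∸ i) (a ∸ j) (d ∸ k))))
  Σ≤³≡∑³ = trans (Σ≤≡∑ n _) (ℤ∑.∑-cong n (λ {i} _ → trans (Σ≤≡∑ a _) (ℤ∑.∑-cong a (λ {j} _ → Σ≤≡∑ d _))))
  ∑³≡⋆ : (F Nested.* G) n a d ≡ ℤ∑.∑ n (λ i → ℤ∑.∑ a (λ j → ℤ∑.∑ d (λ k → F i j k ℤ.* G (n ∸ i) (a ∸ j) (d ∸ k))))
  ∑³≡⋆ = trans (cong (λ h → h d) (PowerSeries.∑-apply ℤ⟦q⟧ n _ a))
                  (trans (PowerSeries.∑-apply ℤₚ.+-*-commutativeRing n _ d)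
                           (ℤ∑.∑-cong n (λ _ → PowerSeries.∑-apply ℤₚ.+-*-commutativeRing a _ d)))

1ₛ≈1 : 1ₛ ≈ Nested.1#
1ₛ≈1 zero    zero    zero    = refl
1ₛ≈1 zero    zero    (suc d) = refl
1ₛ≈1 zero    (suc a) d       = refl
1ₛ≈1 (suc n) a       d       = refl

0ₛ≈0 : 0ₛ ≈ Nested.0#
0ₛ≈0 n a d = ℤₚ.+-inverseʳ (mono 0 0 0 n a d)

seriesRing : CommutativeRing 0ℓ 0ℓ
seriesRing = record
  { Carrier = Series
  ; _≈_     = _≈_
  ; _+_     = _+ₛ_
  ; _*_     = _*ₛ_
  ; -_      = λ F n a d → ℤ.- F n a d
  ; 0#      = 0ₛ
  ; 1#      = 1ₛ
  ; isCommutativeRing = record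
    { isRing = record
      { +-isAbelianGroup = record
        { isGroup = record
          { isMonoid = record
            { isSemigroup = Nested.+-isSemigroup
            ; identity    = (λ F → Nested.trans (Nested.+-congʳ {F} 0ₛ≈0) (Nested.+-identityˡ F))
                          , (λ F → Nested.trans (Nested.+-congˡ {F} 0ₛ≈0) (Nested.+-identityʳ F))
            }
          ; inverse = (λ F → Nested.trans (Nested.-‿inverseˡ F) (Nested.sym 0ₛ≈0))
                    , (λ F → Nested.trans (Nested.-‿inverseʳ F) (Nested.sym 0ₛ≈0))
          ; ⁻¹-cong = Nested.-‿cong
          }
        ; comm = Nested.+-comm
        }
      ; *-cong     = λ {F} {F′} {G} {G′} F≈F′ G≈G′ →
                       Nested.trans (*ₛ≈* F G) (Nested.trans (Nested.*-cong F≈F′ G≈G′) (Nested.sym (*ₛ≈* F′ G′)))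
      ; *-assoc    = λ F G H → Nested.trans (*ₛ≈* (F *ₛ G) H) (Nested.trans (Nested.*-congʳ {H} (*ₛ≈* F G))
                       (Nested.trans (Nested.*-assoc F G H)
                         (Nested.trans (Nested.*-congˡ {F} (Nested.sym (*ₛ≈* G H))) (Nested.sym (*ₛ≈* F (G *ₛ H))))))
      ; *-identity = (λ F → Nested.trans (*ₛ≈* 1ₛ F) (Nested.trans (Nested.*-congʳ {F} 1ₛ≈1) (Nested.*-identityˡ F)))
                   , (λ F → Nested.trans (*ₛ≈* F 1ₛ) (Nested.trans (Nested.*-congˡ {F} 1ₛ≈1) (Nested.*-identityʳ F)))
      ; distrib    = (λ F G H → Nested.trans (*ₛ≈* F (G +ₛ H))
                       (Nested.trans (Nested.distribˡ F G H) (Nested.sym (Nested.+-cong (*ₛ≈* F G) (*ₛ≈* F H)))))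
                   , (λ F G H → Nested.trans (*ₛ≈* (G +ₛ H) F)
                       (Nested.trans (Nested.distribʳ F G H) (Nested.sym (Nested.+-cong (*ₛ≈* G F) (*ₛ≈* H F)))))
      }
    ; *-comm = λ F G → Nested.trans (*ₛ≈* F G) (Nested.trans (Nested.*-comm F G) (Nested.sym (*ₛ≈* G F)))
    }
  }

module SeriesRing = CommutativeRing seriesRing

Σ≤-cong : ∀ n {f g : ℕ → ℤ} → (∀ i → f i ≡ g i) → Σ≤ n f ≡ Σ≤ n g
Σ≤-cong zero    f≗g = f≗g zero
Σ≤-cong (suc n) f≗g = cong₂ ℤ._+_ (Σ≤-cong n f≗g) (f≗g (suc n))

Σ≤-comm : ∀ m n (f : ℕ → ℕ → ℤ) → Σ≤ m (λ i → Σ≤ n (f i)) ≡ Σ≤ n (λ j → Σ≤ m (λ i → f i j))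
Σ≤-comm m n f = begin
  Σ≤ m (λ i → Σ≤ n (f i))                  ≡⟨ trans (Σ≤≡∑ m _) (ℤ∑.∑-cong m (λ _ → Σ≤≡∑ n _)) ⟩
  ℤ∑.∑ m (λ i → ℤ∑.∑ n (f i))              ≡⟨ ℤ∑.∑-comm m n f ⟩
  ℤ∑.∑ n (λ j → ℤ∑.∑ m (λ i → f i j))      ≡⟨ trans (Σ≤≡∑ n _) (ℤ∑.∑-cong n (λ _ → Σ≤≡∑ m _)) ⟨
  Σ≤ n (λ j → Σ≤ m (λ i → f i j))          ∎
  where open ≡-Reasoning

Σ≤-zero : ∀ n {f : ℕ → ℤ} → (∀ {i} → i ≤ n → f i ≡ ℤ.0ℤ) → Σ≤ n f ≡ ℤ.0ℤ
Σ≤-zero n f≡0 = trans (Σ≤≡∑ n _) (ℤ∑.∑-zero n f≡0)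

Σ≤-single : ∀ n {i₀} {f : ℕ → ℤ} → i₀ ≤ n → (∀ {i} → i ≤ n → i ≢ i₀ → f i ≡ ℤ.0ℤ) → Σ≤ n f ≡ f i₀
Σ≤-single n i₀≤n f≡0 = trans (Σ≤≡∑ n _) (ℤ∑.∑-single n i₀≤n f≡0)

pos-∑ : ∀ n f → ℤ.+ ℕ∑.∑ n f ≡ Σ≤ n (λ i → ℤ.+ f i)
pos-∑ zero    f = refl
pos-∑ (suc n) f = trans (ℤₚ.pos-+ (ℕ∑.∑ n f) (f (suc n))) (cong (ℤ._+ ℤ.+ f (suc n)) (pos-∑ n f))

-- Booleans and counting

𝟙 : Bool → ℕ
𝟙 b = if b then 1 else 0

𝟙-∧ : ∀ a b → 𝟙 (a ∧ b) ≡ 𝟙 a * 𝟙 b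
𝟙-∧ true  b = sym (ℕ.+-identityʳ (𝟙 b))
𝟙-∧ false b = refl

𝟙-split : ∀ a b → 𝟙 a ≡ 𝟙 (a ∧ b) + 𝟙 (a ∧ not b)
𝟙-split true  true  = refl
𝟙-split true  false = refl
𝟙-split false _     = refl

𝟙-true : ∀ {b} → T b → 𝟙 b ≡ 1
𝟙-true {true} _ = refl

𝟙-false : ∀ {b} → ¬ T b → 𝟙 b ≡ 0
𝟙-false {false} _   = refl
𝟙-false {true}  ¬tt = contradiction _ ¬tt

T-injective : ∀ {a b} → T a ⇔ T b → a ≡ b
T-injective {true}  {true}  _   = refl
T-injective {true}  {false} a⇔b = contradiction _ (Equivalence.to a⇔b)
T-injective {false} {true}  a⇔b = contradiction _ (Equivalence.from a⇔b)
T-injective {false} {false} _   = refl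

T⇒≡true : ∀ {b} → T b → b ≡ true
T⇒≡true = Equivalence.to T-≡

¬T⇒≡false : ∀ {b} → ¬ T b → b ≡ false
¬T⇒≡false {false} _   = refl
¬T⇒≡false {true}  ¬tt = contradiction _ ¬tt

T⇒¬T-not : ∀ {b} → T b → ¬ T (not b)
T⇒¬T-not {true} _ ()

¬T-not⇒T : ∀ {b} → ¬ T (not b) → T b
¬T-not⇒T {true}  _    = _
¬T-not⇒T {false} ¬T-b = ¬T-b _

T-not⇒¬T : ∀ {b} → T (not b) → ¬ T b
T-not⇒¬T {false} _ ()

¬T⇒T-not : ∀ {b} → ¬ T b → T (not b)
¬T⇒T-not {false} _ = _
¬T⇒T-not {true}  ¬tt = ¬tt _

T-∧³ˡ : ∀ a b {r} → T ((a ∧ b) ∧ r) → T a × T b × T r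
T-∧³ˡ true true t = _ , _ , t

T-∧³ˡ⁻ : ∀ {a b r} → T a → T b → T r → T ((a ∧ b) ∧ r)
T-∧³ˡ⁻ {true} {true} _ _ t = t

T-∧⁴ : ∀ a b c {r} → T (((a ∧ b) ∧ c) ∧ r) → T a × T b × T c × T r
T-∧⁴ true true true t = _ , _ , _ , t

T-∧⁴⁻ : ∀ {a b c r} → T a → T b → T c → T r → T (((a ∧ b) ∧ c) ∧ r)
T-∧⁴⁻ {true} {true} {true} _ _ _ t = t

≡ᵇ-refl : ∀ x → (x ≡ᵇ x) ≡ true
≡ᵇ-refl x = T⇒≡true (ℕ.≡⇒≡ᵇ x x refl)

≡ᵇ-false : ∀ {x y} → x ≢ y → (x ≡ᵇ y) ≡ false
≡ᵇ-false {x} {y} x≢y = ¬T⇒≡false (x≢y ∘ ℕ.≡ᵇ⇒≡ x y)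

+≡ᵇ-∸ : ∀ {u a} z → u ≤ a → (u + z ≡ᵇ a) ≡ (z ≡ᵇ a ∸ u)
+≡ᵇ-∸ {u} {a} z u≤a = T-injective (mk⇔
  (λ t → ℕ.≡⇒≡ᵇ z (a ∸ u) (trans (sym (ℕ.m+n∸m≡n u z)) (cong (_∸ u) (ℕ.≡ᵇ⇒≡ (u + z) a t))))
  (λ t → ℕ.≡⇒≡ᵇ (u + z) a (trans (cong (λ m → u + m) (ℕ.≡ᵇ⇒≡ z (a ∸ u) t)) (ℕ.m+[n∸m]≡n u≤a))))

+≡ᵇ-> : ∀ {u a} z → a < u → (u + z ≡ᵇ a) ≡ false
+≡ᵇ-> {u} z a<u = ≡ᵇ-false (λ u+z≡a → ℕ.<-irrefl refl (ℕ.<-≤-trans a<u (subst (u ≤_) u+z≡a (ℕ.m≤m+n u z))))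

==-false : ∀ {u v} → u ≢ v → (u == v) ≡ false
==-false {u} {v} u≢v with ≡-dec ℕ._≟_ u v
... | yes u≡v = contradiction u≡v u≢v
... | no  _   = refl

module _ {A : Set} where

  countB-++ : ∀ (P : A → Bool) xs ys → countB P (xs ++ ys) ≡ countB P xs + countB P ys
  countB-++ P []       ys = refl
  countB-++ P (x ∷ xs) ys = trans (cong (𝟙 (P x) +_) (countB-++ P xs ys)) (sym (ℕ.+-assoc (𝟙 (P x)) _ _))

  countB-map : ∀ {B : Set} (P : B → Bool) (f : A → B) xs → countB P (map f xs) ≡ countB (P ∘ f) xs
  countB-map P f []       = refl
  countB-map P f (x ∷ xs) = cong (𝟙 (P (f x)) +_) (countB-map P f xs)

  countB-cong : ∀ {P Q : A → Bool} → (∀ x → P x ≡ Q x) → ∀ xs → countB P xs ≡ countB Q xs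
  countB-cong P≗Q []       = refl
  countB-cong P≗Q (x ∷ xs) = cong₂ (λ b n → 𝟙 b + n) (P≗Q x) (countB-cong P≗Q xs)

  countB-split : ∀ (P Q R : A → Bool) → (∀ x → 𝟙 (P x) ≡ 𝟙 (Q x) + 𝟙 (R x)) →
                 ∀ xs → countB P xs ≡ countB Q xs + countB R xs
  countB-split P Q R split []       = refl
  countB-split P Q R split (x ∷ xs) = begin
    𝟙 (P x) + countB P xs                                ≡⟨ cong₂ _+_ (split x) (countB-split P Q R split xs) ⟩
    (𝟙 (Q x) + 𝟙 (R x)) + (countB Q xs + countB R xs)    ≡⟨ interchange (𝟙 (Q x)) (𝟙 (R x)) _ _ ⟩
    (𝟙 (Q x) + countB Q xs) + (𝟙 (R x) + countB R xs)    ∎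
    where open ≡-Reasoning

  countB-none : ∀ {P : A → Bool} xs → (∀ {x} → x ∈ xs → P x ≡ false) → countB P xs ≡ 0
  countB-none []       _       = refl
  countB-none (x ∷ xs) P≡false rewrite P≡false (here refl) = countB-none xs (P≡false ∘ there)

  countB≡length∘filterᵇ : ∀ (P : A → Bool) xs → countB P xs ≡ length (filterᵇ P xs)
  countB≡length∘filterᵇ P []       = refl
  countB≡length∘filterᵇ P (x ∷ xs) with P x
  ... | true  = cong suc (countB≡length∘filterᵇ P xs)
  ... | false = countB≡length∘filterᵇ P xs

  unique-map : ∀ {B : Set} {f : A → B} {xs} → (∀ {x y} → x ∈ xs → y ∈ xs → f x ≡ f y → x ≡ y) →
               Unique xs → Unique (map f xs)
  unique-map {xs = []}     f-inj []         = []
  unique-map {xs = x ∷ xs} f-inj (x∉ ∷ uxs) =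
    All.map⁺ (All.tabulate λ y∈ fx≡fy → All.lookup x∉ y∈ (f-inj (here refl) (there y∈) fx≡fy))
    ∷ unique-map (λ x∈ y∈ → f-inj (there x∈) (there y∈)) uxs

  unique-concatMap : ∀ {B : Set} (f : A → List B) {xs} → Unique xs → (∀ {x} → x ∈ xs → Unique (f x)) →
                     (∀ {x x′ y} → x ∈ xs → x′ ∈ xs → y ∈ f x → y ∈ f x′ → x ≡ x′) →
                     Unique (concatMap f xs)
  unique-concatMap f {[]}     []         _     _        = []
  unique-concatMap f {x ∷ xs} (x∉ ∷ uxs) u-fx  f-disj =
    Unique.++⁺ (u-fx (here refl)) (unique-concatMap f uxs (u-fx ∘ there) (λ p q → f-disj (there p) (there q))) disjoint
    where
    disjoint : Disjoint (f x) (concatMap f xs)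
    disjoint (y∈fx , y∈rest) with x′ , x′∈ , y∈fx′ ← find (∈.∈-concatMap⁻ f y∈rest) =
      All.lookup x∉ x′∈ (f-disj (here refl) (there x′∈) y∈fx y∈fx′)

module _ {A B : Set} (P : A → Bool) (Q : B → Bool) (f : B → A) {xs : List A} {ys : List B} where

  countB-bijection : Unique xs → Unique ys →
    (∀ {y} → y ∈ ys → T (Q y) → f y ∈ xs × T (P (f y))) →
    (∀ {x} → x ∈ xs → T (P x) → ∃ λ y → y ∈ ys × T (Q y) × f y ≡ x) →
    (∀ {y y′} → y ∈ ys → y′ ∈ ys → T (Q y) → T (Q y′) → f y ≡ f y′ → y ≡ y′) →
    countB P xs ≡ countB Q ys
  countB-bijection u-xs u-ys into onto f-inj = begin
    countB P xs                   ≡⟨ countB≡length∘filterᵇ P xs ⟩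
    length (filterᵇ P xs)         ≡⟨ ↭.↭-length (∼bag⇒↭ (unique∧set⇒bag u-P u-fQ same)) ⟩
    length (map f (filterᵇ Q ys)) ≡⟨ List.length-map f (filterᵇ Q ys) ⟩
    length (filterᵇ Q ys)         ≡⟨ countB≡length∘filterᵇ Q ys ⟨
    countB Q ys                   ∎
    where
    open ≡-Reasoning
    u-P : Unique (filterᵇ P xs)
    u-P = Unique.filter⁺ (T? ∘ P) u-xs
    u-fQ : Unique (map f (filterᵇ Q ys))
    u-fQ = unique-map (λ y∈ y′∈ → let y∈ys , Qy = ∈.∈-filter⁻ (T? ∘ Q) y∈ ; y′∈ys , Qy′ = ∈.∈-filter⁻ (T? ∘ Q) y′∈
                                  in f-inj y∈ys y′∈ys Qy Qy′)
                      (Unique.filter⁺ (T? ∘ Q) u-ys)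
    same : ∀ {x} → x ∈ filterᵇ P xs ⇔ x ∈ map f (filterᵇ Q ys)
    same = mk⇔ to from
      where
      to : ∀ {x} → x ∈ filterᵇ P xs → x ∈ map f (filterᵇ Q ys)
      to x∈ with x∈xs , Px ← ∈.∈-filter⁻ (T? ∘ P) x∈ with y , y∈ys , Qy , refl ← onto x∈xs Px =
        ∈.∈-map⁺ f (∈.∈-filter⁺ (T? ∘ Q) y∈ys Qy)
      from : ∀ {x} → x ∈ map f (filterᵇ Q ys) → x ∈ filterᵇ P xs
      from x∈ with y , y∈ , refl ← ∈.∈-map⁻ f x∈ with y∈ys , Qy ← ∈.∈-filter⁻ (T? ∘ Q) y∈ =
        ∈.∈-filter⁺ (T? ∘ P) (proj₁ (into y∈ys Qy)) (proj₂ (into y∈ys Qy))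

module _ {A B : Set} (P : A → Bool) (f g : A → ℕ) (Q : B → Bool) (f′ g′ : B → ℕ) (a d : ℕ) where

  pairTest : A × B → Bool
  pairTest (x , y) = (P x ∧ Q y) ∧ ((f x + f′ y ≡ᵇ a) ∧ (g x + g′ y ≡ᵇ d))

  count₁ : List A → ℕ → ℕ → ℕ
  count₁ xs j k = countB (λ x → P x ∧ ((f x ≡ᵇ j) ∧ (g x ≡ᵇ k))) xs

  count₂ : List B → ℕ → ℕ → ℕ
  count₂ ys j k = countB (λ y → Q y ∧ ((f′ y ≡ᵇ j) ∧ (g′ y ≡ᵇ k))) ys

  -- For fixed x only the term (j , k) = (f x , g x) survives.
  countB-fiber : ∀ x ys →
    countB (λ y → (P x ∧ Q y) ∧ ((f x + f′ y ≡ᵇ a) ∧ (g x + g′ y ≡ᵇ d))) ys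
    ≡ ℕ∑.∑ a (λ j → ℕ∑.∑ d λ k → 𝟙 (P x ∧ ((f x ≡ᵇ j) ∧ (g x ≡ᵇ k))) * count₂ ys (a ∸ j) (d ∸ k))
  countB-fiber x ys with P x
  ... | false = trans (countB-none ys (λ _ → refl)) (sym (ℕ∑.∑-zero a λ _ → ℕ∑.∑-zero d λ _ → refl))
  ... | true with f x ℕ.≤? a | g x ℕ.≤? d
  ...   | no fx≰a | _ =
    trans (countB-none ys λ {y} _ → trans (cong (λ b → Q y ∧ (b ∧ (g x + g′ y ≡ᵇ d))) (+≡ᵇ-> (f′ y) (ℕ.≰⇒> fx≰a)))
                                           (∧-zeroʳ (Q y)))
          (sym (ℕ∑.∑-zero a λ {j} j≤a → ℕ∑.∑-zero d λ {k} _ →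
             cong (λ b → 𝟙 (b ∧ (g x ≡ᵇ k)) * count₂ ys (a ∸ j) (d ∸ k))
                  (≡ᵇ-false λ fx≡j → fx≰a (subst (_≤ a) (sym fx≡j) j≤a))))
  ...   | yes _ | no gx≰d =
    trans (countB-none ys λ {y} _ → trans (cong (λ b → Q y ∧ ((f x + f′ y ≡ᵇ a) ∧ b)) (+≡ᵇ-> (g′ y) (ℕ.≰⇒> gx≰d)))
                                           (trans (cong (Q y ∧_) (∧-zeroʳ _)) (∧-zeroʳ (Q y))))
          (sym (ℕ∑.∑-zero a λ {j} _ → ℕ∑.∑-zero d λ {k} k≤d →
             cong (λ b → 𝟙 b * count₂ ys (a ∸ j) (d ∸ k))
                  (trans (cong ((f x ≡ᵇ j) ∧_) (≡ᵇ-false λ gx≡k → gx≰d (subst (_≤ d) (sym gx≡k) k≤d))) (∧-zeroʳ _))))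
  ...   | yes fx≤a | yes gx≤d = begin
    countB (λ y → Q y ∧ ((f x + f′ y ≡ᵇ a) ∧ (g x + g′ y ≡ᵇ d))) ys
      ≡⟨ countB-cong (λ y → cong₂ (λ b c → Q y ∧ (b ∧ c)) (+≡ᵇ-∸ (f′ y) fx≤a) (+≡ᵇ-∸ (g′ y) gx≤d)) ys ⟩
    C (f x) (g x)
      ≡⟨ ℕ.*-identityˡ _ ⟨
    1 * C (f x) (g x)
      ≡⟨ cong (λ b → 𝟙 b * C (f x) (g x)) (cong₂ _∧_ (≡ᵇ-refl (f x)) (≡ᵇ-refl (g x))) ⟨
    𝟙 ((f x ≡ᵇ f x) ∧ (g x ≡ᵇ g x)) * C (f x) (g x)
      ≡⟨ ℕ∑.∑-single d gx≤d (λ {k} _ k≢gx → cong (λ b → 𝟙 b * C (f x) k)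
           (trans (cong ((f x ≡ᵇ f x) ∧_) (≡ᵇ-false (k≢gx ∘ sym))) (∧-zeroʳ _))) ⟨
    ℕ∑.∑ d (λ k → 𝟙 ((f x ≡ᵇ f x) ∧ (g x ≡ᵇ k)) * C (f x) k)
      ≡⟨ ℕ∑.∑-single a fx≤a (λ {j} _ j≢fx → ℕ∑.∑-zero d λ {k} _ →
           cong (λ b → 𝟙 (b ∧ (g x ≡ᵇ k)) * C j k) (≡ᵇ-false (j≢fx ∘ sym))) ⟨
    ℕ∑.∑ a (λ j → ℕ∑.∑ d λ k → 𝟙 ((f x ≡ᵇ j) ∧ (g x ≡ᵇ k)) * C j k) ∎
    where
    open ≡-Reasoning
    C : ℕ → ℕ → ℕ
    C j k = count₂ ys (a ∸ j) (d ∸ k)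

  countB-cartesianProduct : ∀ xs ys →
    countB pairTest (cartesianProduct xs ys)
    ≡ ℕ∑.∑ a (λ j → ℕ∑.∑ d λ k → count₁ xs j k * count₂ ys (a ∸ j) (d ∸ k))
  countB-cartesianProduct []       ys = sym (ℕ∑.∑-zero a λ _ → ℕ∑.∑-zero d λ _ → refl)
  countB-cartesianProduct (x ∷ xs) ys = begin
    countB pairTest (map (x ,_) ys ++ cartesianProduct xs ys)
      ≡⟨ countB-++ pairTest (map (x ,_) ys) _ ⟩
    countB pairTest (map (x ,_) ys) + countB pairTest (cartesianProduct xs ys)
      ≡⟨ cong₂ _+_ (trans (countB-map pairTest (x ,_) ys) (countB-fiber x ys)) (countB-cartesianProduct xs ys) ⟩
    ℕ∑.∑ a (λ j → ℕ∑.∑ d λ k → 𝟙 (Px=jk j k) * C j k) + ℕ∑.∑ a (λ j → ℕ∑.∑ d λ k → count₁ xs j k * C j k)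
      ≡⟨ ℕ∑.∑-distrib-+ a _ _ ⟨
    ℕ∑.∑ a (λ j → ℕ∑.∑ d (λ k → 𝟙 (Px=jk j k) * C j k) + ℕ∑.∑ d (λ k → count₁ xs j k * C j k))
      ≡⟨ ℕ∑.∑-cong a (λ {j} _ → trans (sym (ℕ∑.∑-distrib-+ d _ _))
           (ℕ∑.∑-cong d (λ {k} _ → sym (ℕ.*-distribʳ-+ (C j k) (𝟙 (Px=jk j k)) (count₁ xs j k))))) ⟩
    ℕ∑.∑ a (λ j → ℕ∑.∑ d λ k → count₁ (x ∷ xs) j k * C j k) ∎
    where
    open ≡-Reasoning
    Px=jk : ℕ → ℕ → Bool
    Px=jk j k = P x ∧ ((f x ≡ᵇ j) ∧ (g x ≡ᵇ k))
    C : ℕ → ℕ → ℕ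
    C j k = count₂ ys (a ∸ j) (d ∸ k)

-- Permutations

-- Listed downwards, so that [1‥ suc n ] = suc n ∷ [1‥ n ] matches perms (suc n), which inserts suc n.
[1‥_] : ℕ → List ℕ
[1‥ zero  ] = []
[1‥ suc n ] = suc n ∷ [1‥ n ]

length-[1‥] : ∀ n → length [1‥ n ] ≡ n
length-[1‥] zero    = refl
length-[1‥] (suc n) = cong suc (length-[1‥] n)

∈-[1‥]⁻ : ∀ {n x} → x ∈ [1‥ n ] → 0 < x × x ≤ n
∈-[1‥]⁻ {suc n} (here refl) = s≤s z≤n , ℕ.≤-refl
∈-[1‥]⁻ {suc n} (there x∈)  = let 0<x , x≤n = ∈-[1‥]⁻ x∈ in 0<x , ℕ.m≤n⇒m≤1+n x≤n

[1‥+] : ∀ m k → [1‥ m + k ] ≡ map (_+ k) [1‥ m ] ++ [1‥ k ]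
[1‥+] zero    k = refl
[1‥+] (suc m) k = cong (suc (m + k) ∷_) ([1‥+] m k)

∈-inserts⁺ : ∀ x u v → u ++ x ∷ v ∈ inserts x (u ++ v)
∈-inserts⁺ x []      []      = here refl
∈-inserts⁺ x []      (y ∷ v) = here refl
∈-inserts⁺ x (y ∷ u) v       = there (∈.∈-map⁺ (y ∷_) (∈-inserts⁺ x u v))

∈-inserts⁻ : ∀ {x v w} → w ∈ inserts x v → ∃₂ λ u u′ → v ≡ u ++ u′ × w ≡ u ++ x ∷ u′
∈-inserts⁻ {v = []}    (here refl) = [] , [] , refl , refl
∈-inserts⁻ {v = y ∷ v} (here refl) = [] , y ∷ v , refl , refl
∈-inserts⁻ {v = y ∷ v} (there w∈)
  with w′ , w′∈ , refl ← ∈.∈-map⁻ (y ∷_) w∈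
  with u , u′ , refl , refl ← ∈-inserts⁻ w′∈ = y ∷ u , u′ , refl , refl

∷-cancel : ∀ {x : ℕ} u₁ u₂ {v₁ v₂} → x ∉ u₁ → x ∉ u₂ → u₁ ++ x ∷ v₁ ≡ u₂ ++ x ∷ v₂ → u₁ ++ v₁ ≡ u₂ ++ v₂
∷-cancel []       []       _   _   eq = List.∷-injectiveʳ eq
∷-cancel []       (y ∷ u₂) _   x∉₂ eq = contradiction (here (List.∷-injectiveˡ eq)) x∉₂
∷-cancel (y ∷ u₁) []       x∉₁ _   eq = contradiction (here (sym (List.∷-injectiveˡ eq))) x∉₁
∷-cancel (y ∷ u₁) (z ∷ u₂) x∉₁ x∉₂ eq =
  cong₂ _∷_ (List.∷-injectiveˡ eq) (∷-cancel u₁ u₂ (x∉₁ ∘ there) (x∉₂ ∘ there) (List.∷-injectiveʳ eq))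

inserts-injective : ∀ {x v v′ w} → x ∉ v → x ∉ v′ → w ∈ inserts x v → w ∈ inserts x v′ → v ≡ v′
inserts-injective x∉v x∉v′ w∈ w∈′
  with u₁ , u₁′ , refl , refl ← ∈-inserts⁻ w∈
  with u₂ , u₂′ , refl , eq   ← ∈-inserts⁻ w∈′ =
  ∷-cancel u₁ u₂ (x∉v ∘ ∈.∈-++⁺ˡ) (x∉v′ ∘ ∈.∈-++⁺ˡ) eq

unique-inserts : ∀ {x v} → x ∉ v → Unique (inserts x v)
unique-inserts {v = []}    _   = [] ∷ []
unique-inserts {v = y ∷ v} x∉ =
  All.map⁺ (All.tabulate λ _ eq → x∉ (here (List.∷-injectiveˡ eq)))
  ∷ Unique.map⁺ List.∷-injectiveʳ (unique-inserts (x∉ ∘ there))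

∈-perms⁻ : ∀ {n w} → w ∈ perms n → w ↭ [1‥ n ]
∈-perms⁻ {zero}  (here refl) = ↭-refl
∈-perms⁻ {suc n} w∈
  with v , v∈ , w∈′ ← find (∈.∈-concatMap⁻ (inserts (suc n)) w∈)
  with u , u′ , refl , refl ← ∈-inserts⁻ w∈′ =
  ↭-trans (↭.shift (suc n) u u′) (prep (suc n) (∈-perms⁻ v∈))

∈-perms⁺ : ∀ {n w} → w ↭ [1‥ n ] → w ∈ perms n
∈-perms⁺ {zero}  w↭ rewrite ↭.↭-empty-inv w↭ = here refl
∈-perms⁺ {suc n} w↭ with u , u′ , refl ← ∈.∈-∃++ (↭.∈-resp-↭ (↭-sym w↭) (here refl)) =
  ∈.∈-concatMap⁺ (inserts (suc n)) (lose (∈-perms⁺ (↭.drop-mid u [] w↭)) (∈-inserts⁺ (suc n) u u′))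

1+n∉perm : ∀ {n v} → v ∈ perms n → suc n ∉ v
1+n∉perm v∈ 1+n∈ = ℕ.<-irrefl refl (proj₂ (∈-[1‥]⁻ (↭.∈-resp-↭ (∈-perms⁻ v∈) 1+n∈)))

unique-perms : ∀ n → Unique (perms n)
unique-perms zero    = [] ∷ []
unique-perms (suc n) = unique-concatMap (inserts (suc n)) (unique-perms n)
  (unique-inserts ∘ 1+n∉perm)
  (λ v∈ v′∈ → inserts-injective (1+n∉perm v∈) (1+n∉perm v′∈))

∈perms⇒length : ∀ {n w} → w ∈ perms n → length w ≡ n
∈perms⇒length {n} w∈ = trans (↭.↭-length (∈-perms⁻ {n} w∈)) (length-[1‥] n)

reverse-∈perms : ∀ {n w} → w ∈ perms n → reverse w ∈ perms n
reverse-∈perms {n} {w} w∈ = ∈-perms⁺ (↭-trans (↭.↭-reverse w) (∈-perms⁻ {n} w∈))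

-- Separable permutations

data NonEmpty {A : Set} : List A → Set where
  nonEmpty : ∀ {x xs} → NonEmpty (x ∷ xs)

map⁺-NonEmpty : ∀ {A B : Set} {f : A → B} {xs} → NonEmpty xs → NonEmpty (map f xs)
map⁺-NonEmpty nonEmpty = nonEmpty

data Separable : List ℕ → Set where
  one    : Separable (1 ∷ [])
  direct : ∀ {π σ} → Separable π → Separable σ → Separable (π ⊕ σ)
  skew   : ∀ {π σ} → Separable π → Separable σ → Separable (π ⊖ σ)

length-⊕ : ∀ π σ → length (π ⊕ σ) ≡ length π + length σ
length-⊕ π σ = trans (List.length-++ π) (cong (length π +_) (List.length-map _ σ))

length-⊖ : ∀ π σ → length (π ⊖ σ) ≡ length π + length σ
length-⊖ π σ = trans (List.length-++ (map _ π)) (cong (_+ length σ) (List.length-map _ π))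

⊕-↭ : ∀ {π σ} → π ↭ [1‥ length π ] → σ ↭ [1‥ length σ ] → π ⊕ σ ↭ [1‥ length (π ⊕ σ) ]
⊕-↭ {π} {σ} π↭ σ↭ = begin
  π ++ map (_+ length π) σ                           ↭⟨ ↭.++⁺ π↭ (↭.map⁺ _ σ↭) ⟩
  [1‥ length π ] ++ map (_+ length π) [1‥ length σ ] ↭⟨ ↭.++-comm [1‥ length π ] (map (_+ length π) [1‥ length σ ]) ⟩
  map (_+ length π) [1‥ length σ ] ++ [1‥ length π ] ≡⟨ [1‥+] (length σ) (length π) ⟨
  [1‥ length σ + length π ]
    ≡⟨ cong [1‥_] (trans (ℕ.+-comm (length σ) (length π)) (sym (length-⊕ π σ))) ⟩
  [1‥ length (π ⊕ σ) ]                                ∎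
  where open PermutationReasoning

⊖-↭ : ∀ {π σ} → π ↭ [1‥ length π ] → σ ↭ [1‥ length σ ] → π ⊖ σ ↭ [1‥ length (π ⊖ σ) ]
⊖-↭ {π} {σ} π↭ σ↭ = begin
  map (_+ length σ) π ++ σ                            ↭⟨ ↭.++⁺ (↭.map⁺ _ π↭) σ↭ ⟩
  map (_+ length σ) [1‥ length π ] ++ [1‥ length σ ]  ≡⟨ [1‥+] (length π) (length σ) ⟨
  [1‥ length π + length σ ]                           ≡⟨ cong [1‥_] (sym (length-⊖ π σ)) ⟩
  [1‥ length (π ⊖ σ) ]                                ∎
  where open PermutationReasoning

Separable⇒↭ : ∀ {w} → Separable w → w ↭ [1‥ length w ]
Separable⇒↭ one        = ↭-refl
Separable⇒↭ (direct p s) = ⊕-↭ (Separable⇒↭ p) (Separable⇒↭ s)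
Separable⇒↭ (skew p s)   = ⊖-↭ (Separable⇒↭ p) (Separable⇒↭ s)

Separable⇒∈perms : ∀ {w} → Separable w → w ∈ perms (length w)
Separable⇒∈perms = ∈-perms⁺ ∘ Separable⇒↭

Separable⇒NonEmpty : ∀ {w} → Separable w → NonEmpty w
Separable⇒NonEmpty one = nonEmpty
Separable⇒NonEmpty (direct p _) with Separable⇒NonEmpty p
... | nonEmpty = nonEmpty
Separable⇒NonEmpty (skew p _) with Separable⇒NonEmpty p
... | nonEmpty = nonEmpty

∈-splits : ∀ {xs ys : List ℕ} → NonEmpty xs → NonEmpty ys → length xs ∈ splits (xs ++ ys)
∈-splits {_ ∷ xs} {ys} nonEmpty nonEmpty =
  ∈.∈-map⁺ suc (∈.∈-upTo⁺ (subst (length xs <_) (sym (List.length-++ xs)) (ℕ.m<m+n (length xs) (s≤s z≤n))))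

take-length-++ : ∀ (xs ys : List ℕ) → take (length xs) (xs ++ ys) ≡ xs
take-length-++ []       ys = refl
take-length-++ (x ∷ xs) ys = cong (x ∷_) (take-length-++ xs ys)

drop-length-++ : ∀ (xs ys : List ℕ) → drop (length xs) (xs ++ ys) ≡ ys
drop-length-++ []       ys = refl
drop-length-++ (x ∷ xs) ys = drop-length-++ xs ys

map-∸-+ : ∀ m (σ : List ℕ) → map (_∸ m) (map (_+ m) σ) ≡ σ
map-∸-+ m []      = refl
map-∸-+ m (x ∷ σ) = cong₂ _∷_ (ℕ.m+n∸n≡m x m) (map-∸-+ m σ)

directTest skewTest : ℕ → List ℕ → ℕ → Bool
directTest k w i = (w == (take i w ⊕ map (_∸ i) (drop i w))) ∧ sepF k (take i w) ∧ sepF k (map (_∸ i) (drop i w))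
skewTest   k w i = (w == (map (_∸ (length w ∸ i)) (take i w) ⊖ drop i w))
                   ∧ sepF k (map (_∸ (length w ∸ i)) (take i w)) ∧ sepF k (drop i w)

directTest⁻ : ∀ k w i → T (directTest k w i) → ∃₂ λ π σ → w ≡ π ⊕ σ × T (sepF k π) × T (sepF k σ)
directTest⁻ k w i h with ≡-dec ℕ._≟_ w (take i w ⊕ map (_∸ i) (drop i w))
... | yes w≡ = _ , _ , w≡ , Equivalence.to T-∧ h
... | no  _  = ⊥-elim h

skewTest⁻ : ∀ k w i → T (skewTest k w i) → ∃₂ λ π σ → w ≡ π ⊖ σ × T (sepF k π) × T (sepF k σ)
skewTest⁻ k w i h with ≡-dec ℕ._≟_ w (map (_∸ (length w ∸ i)) (take i w) ⊖ drop i w)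
... | yes w≡ = _ , _ , w≡ , Equivalence.to T-∧ h
... | no  _  = ⊥-elim h

sepF-sound : ∀ k w → T (sepF k w) → Separable w
sepF-sound (suc k) w h with Equivalence.to T-∨ h
... | inj₁ w≡1 = subst Separable (sym (toWitness w≡1)) one
... | inj₂ h′
  with i , _ , hᵢ ← find (Any.any⁻ (λ i → directTest k w i ∨ skewTest k w i) (splits w) h′)
  with Equivalence.to (T-∨ {directTest k w i}) hᵢ
... | inj₁ h⊕ with π , σ , w≡ , sπ , sσ ← directTest⁻ k w i h⊕ =
  subst Separable (sym w≡) (direct (sepF-sound k π sπ) (sepF-sound k σ sσ))
... | inj₂ h⊖ with π , σ , w≡ , sπ , sσ ← skewTest⁻ k w i h⊖ =
  subst Separable (sym w≡) (skew (sepF-sound k π sπ) (sepF-sound k σ sσ))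

directTest⁺ : ∀ k π σ → T (sepF k π) → T (sepF k σ) → T (directTest k (π ⊕ σ) (length π))
directTest⁺ k π σ sπ sσ
  rewrite take-length-++ π (map (_+ length π) σ) | drop-length-++ π (map (_+ length π) σ) | map-∸-+ (length π) σ
  with ≡-dec ℕ._≟_ (π ⊕ σ) (π ⊕ σ)
... | yes _ = Equivalence.from T-∧ (sπ , sσ)
... | no ≢  = contradiction refl ≢

skewTest⁺ : ∀ k π σ → T (sepF k π) → T (sepF k σ) → T (skewTest k (π ⊖ σ) (length (map (_+ length σ) π)))
skewTest⁺ k π σ sπ sσ
  rewrite take-length-++ (map (_+ length σ) π) σ | drop-length-++ (map (_+ length σ) π) σ
        | List.length-++ (map (_+ length σ) π) {σ} | ℕ.m+n∸m≡n (length (map (_+ length σ) π)) (length σ)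
        | map-∸-+ (length σ) π
  with ≡-dec ℕ._≟_ (π ⊖ σ) (π ⊖ σ)
... | yes _ = Equivalence.from T-∧ (sπ , sσ)
... | no ≢  = contradiction refl ≢

sepF-split : ∀ k w i → i ∈ splits w → T (directTest k w i ∨ skewTest k w i) → T (sepF (suc k) w)
sepF-split k w i i∈ h = Equivalence.from (T-∨ {w == (1 ∷ [])}) (inj₂ (Any.any⁺ _ (lose i∈ h)))

summands-≤ : ∀ {π σ : List ℕ} {k} → NonEmpty π → NonEmpty σ → length π + length σ ≤ suc k →
             length π ≤ k × length σ ≤ k
summands-≤ nonEmpty nonEmpty ≤1+k =
  ℕ.≤-pred (ℕ.≤-trans (ℕ.m<m+n _ (s≤s z≤n)) ≤1+k) , ℕ.≤-pred (ℕ.≤-trans (ℕ.m<n+m _ (s≤s z≤n)) ≤1+k)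

sepF-complete : ∀ {w} → Separable w → ∀ k → length w ≤ k → T (sepF k w)
sepF-complete s zero w≤0 with Separable⇒NonEmpty s | w≤0
... | nonEmpty | ()
sepF-complete one                  (suc k) _   = _
sepF-complete (direct {π} {σ} p s) (suc k) w≤1+k
  with π≤k , σ≤k ← summands-≤ (Separable⇒NonEmpty p) (Separable⇒NonEmpty s) (subst (_≤ suc k) (length-⊕ π σ) w≤1+k) =
  sepF-split k (π ⊕ σ) (length π) (∈-splits (Separable⇒NonEmpty p) (map⁺-NonEmpty (Separable⇒NonEmpty s)))
    (Equivalence.from (T-∨ {directTest k (π ⊕ σ) (length π)})
      (inj₁ (directTest⁺ k π σ (sepF-complete p k π≤k) (sepF-complete s k σ≤k))))
sepF-complete (skew {π} {σ} p s) (suc k) w≤1+k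
  with π≤k , σ≤k ← summands-≤ (Separable⇒NonEmpty p) (Separable⇒NonEmpty s) (subst (_≤ suc k) (length-⊖ π σ) w≤1+k) =
  sepF-split k (π ⊖ σ) (length (map (_+ length σ) π))
    (∈-splits (map⁺-NonEmpty (Separable⇒NonEmpty p)) (Separable⇒NonEmpty s))
    (Equivalence.from (T-∨ {directTest k (π ⊖ σ) (length (map (_+ length σ) π))})
      (inj₂ (skewTest⁺ k π σ (sepF-complete p k π≤k) (sepF-complete s k σ≤k))))

isSeparable⇒Separable : ∀ w → T (isSeparable w) → Separable w
isSeparable⇒Separable w = sepF-sound (length w) w

Separable⇒isSeparable : ∀ {w} → Separable w → T (isSeparable w)
Separable⇒isSeparable {w} s = sepF-complete s (length w) ℕ.≤-refl

-- Direct sums and irreducibility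

Below : List ℕ → List ℕ → Set
Below xs ys = ∀ {x y} → x ∈ xs → y ∈ ys → x < y

record Reducible (w : List ℕ) : Set where
  constructor reducible
  field
    prefix suffix    : List ℕ
    prefix-nonEmpty  : NonEmpty prefix
    suffix-nonEmpty  : NonEmpty suffix
    below            : Below prefix suffix
    w≡prefix++suffix : w ≡ prefix ++ suffix

belowAt : List ℕ → ℕ → Bool
belowAt w j = all (λ x → all (λ y → x <ᵇ y) (drop j w)) (take j w)

Reducible⇒¬irreducible : ∀ {w} → Reducible w → ¬ T (isIrreducible w)
Reducible⇒¬irreducible (reducible xs ys nxs nys below refl) =
  T⇒¬T-not (Any.any⁺ (belowAt (xs ++ ys)) (lose (∈-splits nxs nys) cut))
  where
  cut : T (belowAt (xs ++ ys) (length xs))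
  cut rewrite take-length-++ xs ys | drop-length-++ xs ys =
    All.all⁻ _ (All.tabulate λ x∈ → All.all⁻ _ (All.tabulate λ y∈ → ℕ.<⇒<ᵇ (below x∈ y∈)))

NonEmpty-length : ∀ {A : Set} {xs : List A} → 0 < length xs → NonEmpty xs
NonEmpty-length {xs = _ ∷ _} _ = nonEmpty

¬irreducible⇒Reducible : ∀ {w} → ¬ T (isIrreducible w) → Reducible w
¬irreducible⇒Reducible {w} ¬irr
  with j , j∈ , cut ← find (Any.any⁻ (belowAt w) (splits w) (¬T-not⇒T ¬irr))
  with j′ , j′∈ , refl ← ∈.∈-map⁻ suc j∈ =
  reducible (take (suc j′) w) (drop (suc j′) w)
            (take-nonEmpty w (ℕ.<-trans (s≤s z≤n) 1+j′<w)) (NonEmpty-length drop-length>0)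
            (λ x∈ y∈ → ℕ.<ᵇ⇒< _ _ (All.lookup (All.all⁺ _ _ (All.lookup (All.all⁺ _ _ cut) x∈)) y∈))
            (sym (List.take++drop≡id (suc j′) w))
  where
  1+j′<w : suc j′ < length w
  1+j′<w = <∸1 (length w) (∈.∈-upTo⁻ j′∈)
    where
    <∸1 : ∀ n → j′ < n ∸ 1 → suc j′ < n
    <∸1 (suc n) j′<n = s≤s j′<n
  take-nonEmpty : ∀ w → 0 < length w → NonEmpty (take (suc j′) w)
  take-nonEmpty (_ ∷ _) _ = nonEmpty
  drop-length>0 : 0 < length (drop (suc j′) w)
  drop-length>0 = subst (0 <_) (sym (List.length-drop (suc j′) w)) (ℕ.m<n⇒0<n∸m 1+j′<w)

irreducible⇒¬Reducible : ∀ {w} → T (isIrreducible w) → ¬ Reducible w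
irreducible⇒¬Reducible irr r = Reducible⇒¬irreducible r irr

¬Reducible⇒irreducible : ∀ {w} → ¬ Reducible w → T (isIrreducible w)
¬Reducible⇒irreducible {w} ¬r = decidable-stable (T? (isIrreducible w)) (¬r ∘ ¬irreducible⇒Reducible)

Reducible⇒≢[1] : ∀ {w} → Reducible w → w ≢ 1 ∷ []
Reducible⇒≢[1] r refl = Reducible⇒¬irreducible r _

Separable-bounds : ∀ {w x} → Separable w → x ∈ w → 0 < x × x ≤ length w
Separable-bounds s x∈ = ∈-[1‥]⁻ (↭.∈-resp-↭ (Separable⇒↭ s) x∈)

Separable-below : ∀ {π σ} → Separable π → Separable σ → Below π (map (_+ length π) σ)
Separable-below {π} p s x∈ y∈ with y , y∈σ , refl ← ∈.∈-map⁻ (_+ length π) y∈ =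
  ℕ.≤-<-trans (proj₂ (Separable-bounds p x∈)) (ℕ.m<n+m (length π) (proj₁ (Separable-bounds s y∈σ)))

⊕-Reducible : ∀ {π σ} → Separable π → Separable σ → Reducible (π ⊕ σ)
⊕-Reducible {π} {σ} p s =
  reducible π (map (_+ length π) σ) (Separable⇒NonEmpty p) (map⁺-NonEmpty (Separable⇒NonEmpty s))
            (Separable-below p s) refl

++-split : ∀ {A : Set} (xs ys us vs : List A) → xs ++ ys ≡ us ++ vs →
           ∃ λ zs → (us ≡ xs ++ zs × ys ≡ zs ++ vs) ⊎ (xs ≡ us ++ zs × vs ≡ zs ++ ys)
++-split []       ys us       vs eq = us , inj₁ (refl , eq)
++-split (x ∷ xs) ys []       vs eq = x ∷ xs , inj₂ (refl , sym eq)
++-split (x ∷ xs) ys (u ∷ us) vs eq with refl , eq′ ← List.∷-injective eq with ++-split xs ys us vs eq′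
... | zs , inj₁ (us≡ , ys≡) = zs , inj₁ (cong (x ∷_) us≡ , ys≡)
... | zs , inj₂ (xs≡ , vs≡) = zs , inj₂ (cong (x ∷_) xs≡ , vs≡)

head-∈ : ∀ {A : Set} {xs : List A} → NonEmpty xs → ∃ λ x → x ∈ xs
head-∈ (nonEmpty {x}) = x , here refl

opposite-splits⇒⊥ : ∀ {xs ys us vs} → Below xs ys → Below vs us → xs ++ ys ≡ us ++ vs →
           NonEmpty xs → NonEmpty ys → NonEmpty us → NonEmpty vs → ⊥
opposite-splits⇒⊥ {xs} {ys} {us} {vs} xs<ys vs<us eq nxs nys nus nvs with ++-split xs ys us vs eq
... | zs , inj₁ (refl , refl) with x , x∈ ← head-∈ nxs | v , v∈ ← head-∈ nvs =
  ℕ.<-asym (xs<ys x∈ (∈.∈-++⁺ʳ zs v∈)) (vs<us v∈ (∈.∈-++⁺ˡ x∈))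
... | zs , inj₂ (refl , refl) with u , u∈ ← head-∈ nus | y , y∈ ← head-∈ nys =
  ℕ.<-asym (xs<ys (∈.∈-++⁺ˡ u∈) y∈) (vs<us (∈.∈-++⁺ʳ zs y∈) u∈)

⊖-irreducible : ∀ {π σ} → Separable π → Separable σ → ¬ Reducible (π ⊖ σ)
⊖-irreducible p s (reducible xs ys nxs nys xs<ys eq) =
  opposite-splits⇒⊥ xs<ys (Separable-below s p) (sym eq) nxs nys
                    (map⁺-NonEmpty (Separable⇒NonEmpty p)) (Separable⇒NonEmpty s)

map-+-+ : ∀ m n (xs : List ℕ) → map (_+ (m + n)) xs ≡ map (_+ m) (map (_+ n) xs)
map-+-+ m n xs =
  trans (List.map-cong (λ x → trans (cong (x +_) (ℕ.+-comm m n)) (sym (ℕ.+-assoc x n m))) xs) (List.map-∘ xs)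

⊕-assoc : ∀ α β γ → (α ⊕ β) ⊕ γ ≡ α ⊕ (β ⊕ γ)
⊕-assoc α β γ = begin
  (α ++ map (_+ length α) β) ++ map (_+ length (α ⊕ β)) γ
    ≡⟨ List.++-assoc α _ _ ⟩
  α ++ (map (_+ length α) β ++ map (_+ length (α ⊕ β)) γ)
    ≡⟨ cong (λ m → α ++ (map (_+ length α) β ++ map (_+ m) γ)) (length-⊕ α β) ⟩
  α ++ (map (_+ length α) β ++ map (_+ (length α + length β)) γ)
    ≡⟨ cong (λ l → α ++ (map (_+ length α) β ++ l)) (map-+-+ (length α) (length β) γ) ⟩
  α ++ (map (_+ length α) β ++ map (_+ length α) (map (_+ length β) γ))
    ≡⟨ cong (α ++_) (List.map-++ (_+ length α) β _) ⟨
  α ++ map (_+ length α) (β ⊕ γ)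
    ∎
  where open ≡-Reasoning

⊕-decompose : ∀ {w} → Separable w → Reducible w →
              ∃₂ λ α β → w ≡ α ⊕ β × Separable α × Separable β × T (isIrreducible α)
⊕-decompose one r = ⊥-elim (Reducible⇒¬irreducible r _)
⊕-decompose (direct {π} {σ} p s) _ with T? (isIrreducible π)
... | yes irr = π , σ , refl , p , s , irr
... | no  red with α , β , refl , a , b , irr ← ⊕-decompose p (¬irreducible⇒Reducible red) =
  α , β ⊕ σ , ⊕-assoc α β σ , a , direct b s , irr
⊕-decompose (skew p s) r = ⊥-elim (⊖-irreducible p s r)

prefix-Reducible : ∀ {α β α′ zs rest} → Separable α → Separable β → α′ ≡ α ++ zs →
                   map (_+ length α) β ≡ zs ++ rest → NonEmpty zs → Reducible α′
prefix-Reducible {α} a b refl β≡ nzs =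
  reducible α _ (Separable⇒NonEmpty a) nzs (λ x∈ z∈ → Separable-below a b x∈ (subst (_ ∈_) (sym β≡) (∈.∈-++⁺ˡ z∈))) refl

⊕-unique : ∀ {α β α′ β′} → Separable α → Separable β → Separable α′ → Separable β′ →
           T (isIrreducible α) → T (isIrreducible α′) → α ⊕ β ≡ α′ ⊕ β′ → α ≡ α′ × β ≡ β′
⊕-unique {α} {β} {α′} {β′} a b a′ b′ irr irr′ eq = α≡α′ , β≡β′
  where
  α≡α′ : α ≡ α′
  α≡α′ with ++-split α _ α′ _ eq
  ... | []    , inj₁ (α′≡ , _)  = sym (trans α′≡ (List.++-identityʳ α))
  ... | _ ∷ _ , inj₁ (α′≡ , β≡) = ⊥-elim (irreducible⇒¬Reducible irr′ (prefix-Reducible a b α′≡ β≡ nonEmpty))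
  ... | []    , inj₂ (α≡ , _)   = trans α≡ (List.++-identityʳ α′)
  ... | _ ∷ _ , inj₂ (α≡ , β′≡) = ⊥-elim (irreducible⇒¬Reducible irr (prefix-Reducible a′ b′ α≡ β′≡ nonEmpty))
  β≡β′ : β ≡ β′
  β≡β′ = List.map-injective (ℕ.+-cancelʳ-≡ (length α) _ _)
           (List.++-cancelˡ α _ _ (subst (λ a → α ⊕ β ≡ a ⊕ β′) (sym α≡α′) eq))

-- Reversal

reverse-⊕ : ∀ π σ → reverse (π ⊕ σ) ≡ reverse σ ⊖ reverse π
reverse-⊕ π σ = begin
  reverse (π ++ map (_+ length π) σ)          ≡⟨ List.reverse-++ π _ ⟩
  reverse (map (_+ length π) σ) ++ reverse π  ≡⟨ cong (_++ reverse π) (List.reverse-map _ σ) ⟨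
  map (_+ length π) (reverse σ) ++ reverse π  ≡⟨ cong (λ m → map (_+ m) (reverse σ) ++ reverse π) (List.length-reverse π) ⟨
  reverse σ ⊖ reverse π                       ∎
  where open ≡-Reasoning

reverse-⊖ : ∀ π σ → reverse (π ⊖ σ) ≡ reverse σ ⊕ reverse π
reverse-⊖ π σ = begin
  reverse (map (_+ length σ) π ++ σ)          ≡⟨ List.reverse-++ (map _ π) σ ⟩
  reverse σ ++ reverse (map (_+ length σ) π)  ≡⟨ cong (reverse σ ++_) (List.reverse-map _ π) ⟨
  reverse σ ++ map (_+ length σ) (reverse π)  ≡⟨ cong (λ m → reverse σ ++ map (_+ m) (reverse π)) (List.length-reverse σ) ⟨
  reverse σ ⊕ reverse π                       ∎
  where open ≡-Reasoning

Separable-reverse : ∀ {w} → Separable w → Separable (reverse w)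
Separable-reverse one                  = one
Separable-reverse (direct {π} {σ} p s) =
  subst Separable (sym (reverse-⊕ π σ)) (skew (Separable-reverse s) (Separable-reverse p))
Separable-reverse (skew {π} {σ} p s)   =
  subst Separable (sym (reverse-⊖ π σ)) (direct (Separable-reverse s) (Separable-reverse p))

isSeparable-reverse : ∀ w → isSeparable (reverse w) ≡ isSeparable w
isSeparable-reverse w = T-injective (mk⇔
  (λ sep-w′ → Separable⇒isSeparable (subst Separable (List.reverse-involutive w)
                                       (Separable-reverse (isSeparable⇒Separable (reverse w) sep-w′))))
  (λ sep-w → Separable⇒isSeparable (Separable-reverse (isSeparable⇒Separable w sep-w))))

reverse-⊕-irreducible : ∀ {π σ} → Separable π → Separable σ → ¬ Reducible (reverse (π ⊕ σ))
reverse-⊕-irreducible {π} {σ} p s =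
  subst (¬_ ∘ Reducible) (sym (reverse-⊕ π σ)) (⊖-irreducible (Separable-reverse s) (Separable-reverse p))

reverse-⊖-Reducible : ∀ {π σ} → Separable π → Separable σ → Reducible (reverse (π ⊖ σ))
reverse-⊖-Reducible {π} {σ} p s =
  subst Reducible (sym (reverse-⊖ π σ)) (⊕-Reducible (Separable-reverse s) (Separable-reverse p))

-- Ascents and descents

asc-below : ∀ {xs ys} → Below xs ys → NonEmpty xs → NonEmpty ys → asc (xs ++ ys) ≡ suc (asc xs + asc ys)
asc-below {x ∷ []}     {y ∷ ys} xs<ys _ _ = cong (_+ asc (y ∷ ys)) (𝟙-true (ℕ.<⇒<ᵇ (xs<ys (here refl) (here refl))))
asc-below {x ∷ x′ ∷ xs} {ys}    xs<ys _ nys = begin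
  𝟙 (x <ᵇ x′) + asc (x′ ∷ xs ++ ys)                    ≡⟨ cong (𝟙 (x <ᵇ x′) +_) (asc-below (xs<ys ∘ there) nonEmpty nys) ⟩
  𝟙 (x <ᵇ x′) + suc (asc (x′ ∷ xs) + asc ys)            ≡⟨ ℕ.+-suc _ _ ⟩
  suc (𝟙 (x <ᵇ x′) + (asc (x′ ∷ xs) + asc ys))          ≡⟨ cong suc (ℕ.+-assoc (𝟙 (x <ᵇ x′)) _ _) ⟨
  suc (asc (x ∷ x′ ∷ xs) + asc ys)                      ∎
  where open ≡-Reasoning

des-below : ∀ {xs ys} → Below xs ys → des (xs ++ ys) ≡ des xs + des ys
des-below {[]}          {ys}     xs<ys = refl
des-below {x ∷ []}      {[]}     xs<ys = refl
des-below {x ∷ []}      {y ∷ ys} xs<ys =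
  cong (_+ des (y ∷ ys)) (𝟙-false (ℕ.<-asym (xs<ys (here refl) (here refl)) ∘ ℕ.<ᵇ⇒< y x))
des-below {x ∷ x′ ∷ xs} {ys}     xs<ys =
  trans (cong (𝟙 (x′ <ᵇ x) +_) (des-below (xs<ys ∘ there))) (sym (ℕ.+-assoc (𝟙 (x′ <ᵇ x)) _ _))

<ᵇ-+ : ∀ m x y → ((x + m) <ᵇ (y + m)) ≡ (x <ᵇ y)
<ᵇ-+ m x y rewrite ℕ.+-comm x m | ℕ.+-comm y m = <ᵇ-+ˡ m
  where
  <ᵇ-+ˡ : ∀ m → ((m + x) <ᵇ (m + y)) ≡ (x <ᵇ y)
  <ᵇ-+ˡ zero    = refl
  <ᵇ-+ˡ (suc m) = <ᵇ-+ˡ m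

asc-map-+ : ∀ m w → asc (map (_+ m) w) ≡ asc w
asc-map-+ m []          = refl
asc-map-+ m (x ∷ [])    = refl
asc-map-+ m (x ∷ y ∷ w) = cong₂ _+_ (cong 𝟙 (<ᵇ-+ m x y)) (asc-map-+ m (y ∷ w))

des-map-+ : ∀ m w → des (map (_+ m) w) ≡ des w
des-map-+ m []          = refl
des-map-+ m (x ∷ [])    = refl
des-map-+ m (x ∷ y ∷ w) = cong₂ _+_ (cong 𝟙 (<ᵇ-+ m y x)) (des-map-+ m (y ∷ w))

asc-⊕ : ∀ {π σ} → Separable π → Separable σ → asc (π ⊕ σ) ≡ suc (asc π + asc σ)
asc-⊕ {π} {σ} p s =
  trans (asc-below (Separable-below p s) (Separable⇒NonEmpty p) (map⁺-NonEmpty (Separable⇒NonEmpty s)))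
        (cong (λ n → suc (asc π + n)) (asc-map-+ (length π) σ))

des-⊕ : ∀ {π σ} → Separable π → Separable σ → des (π ⊕ σ) ≡ des π + des σ
des-⊕ {π} {σ} p s = trans (des-below (Separable-below p s)) (cong (des π +_) (des-map-+ (length π) σ))

asc-∷ʳ : ∀ xs y x → asc (xs ++ y ∷ x ∷ []) ≡ asc (xs ++ y ∷ []) + 𝟙 (y <ᵇ x)
asc-∷ʳ []           y x = ℕ.+-identityʳ _
asc-∷ʳ (z ∷ [])     y x =
  trans (cong (𝟙 (z <ᵇ y) +_) (ℕ.+-identityʳ _)) (cong (_+ 𝟙 (y <ᵇ x)) (sym (ℕ.+-identityʳ _)))
asc-∷ʳ (z ∷ z′ ∷ xs) y x =
  trans (cong (𝟙 (z <ᵇ z′) +_) (asc-∷ʳ (z′ ∷ xs) y x)) (sym (ℕ.+-assoc (𝟙 (z <ᵇ z′)) _ _))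

asc-reverse : ∀ w → asc (reverse w) ≡ des w
asc-reverse []          = refl
asc-reverse (x ∷ [])    = refl
asc-reverse (x ∷ y ∷ w) = begin
  asc (reverse (x ∷ y ∷ w))                 ≡⟨ cong asc reverse-x∷y∷w ⟩
  asc (reverse w ++ y ∷ x ∷ [])             ≡⟨ asc-∷ʳ (reverse w) y x ⟩
  asc (reverse w ++ y ∷ []) + 𝟙 (y <ᵇ x)    ≡⟨ cong (λ l → asc l + 𝟙 (y <ᵇ x)) (List.unfold-reverse y w) ⟨
  asc (reverse (y ∷ w)) + 𝟙 (y <ᵇ x)        ≡⟨ cong (_+ 𝟙 (y <ᵇ x)) (asc-reverse (y ∷ w)) ⟩
  des (y ∷ w) + 𝟙 (y <ᵇ x)                  ≡⟨ ℕ.+-comm (des (y ∷ w)) _ ⟩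
  des (x ∷ y ∷ w)                           ∎
  where
  open ≡-Reasoning
  reverse-x∷y∷w : reverse (x ∷ y ∷ w) ≡ reverse w ++ y ∷ x ∷ []
  reverse-x∷y∷w = trans (List.unfold-reverse x (y ∷ w))
    (trans (cong (λ l → l ++ x ∷ []) (List.unfold-reverse y w)) (List.++-assoc (reverse w) (y ∷ []) (x ∷ [])))

des-reverse : ∀ w → des (reverse w) ≡ asc w
des-reverse w = trans (sym (asc-reverse (reverse w))) (cong asc (List.reverse-involutive w))

-- Generating functions

genFun-cong : ∀ P Q → (∀ π → P π ≡ Q π) → genFun P ≈ genFun Q
genFun-cong P Q P≗Q n a d = cong ℤ.+_ (countB-cong {P = λ π → P π ∧ stats π} (λ π → cong (_∧ stats π) (P≗Q π)) (perms n))
  where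
  stats : List ℕ → Bool
  stats π = (asc π ≡ᵇ a) ∧ (des π ≡ᵇ d)

genFun-split : ∀ P Q R → (∀ π → 𝟙 (P π) ≡ 𝟙 (Q π) + 𝟙 (R π)) → genFun P ≈ genFun Q +ₛ genFun R
genFun-split P Q R split n a d =
  trans (cong ℤ.+_ (countB-split (λ π → P π ∧ stats π) (λ π → Q π ∧ stats π) (λ π → R π ∧ stats π) split∧stats (perms n)))
        (ℤₚ.pos-+ (countB (λ π → Q π ∧ stats π) (perms n)) (countB (λ π → R π ∧ stats π) (perms n)))
  where
  stats : List ℕ → Bool
  stats π = (asc π ≡ᵇ a) ∧ (des π ≡ᵇ d)
  split∧stats : ∀ π → 𝟙 (P π ∧ stats π) ≡ 𝟙 (Q π ∧ stats π) + 𝟙 (R π ∧ stats π)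
  split∧stats π rewrite 𝟙-∧ (P π) (stats π) | 𝟙-∧ (Q π) (stats π) | 𝟙-∧ (R π) (stats π) | split π =
    ℕ.*-distribʳ-+ _ (𝟙 (Q π)) (𝟙 (R π))

tₛ≈genFun[1] : tₛ ≈ genFun (_== (1 ∷ []))
tₛ≈genFun[1] zero                a       d       = refl
tₛ≈genFun[1] (suc zero)          zero    zero    = refl
tₛ≈genFun[1] (suc zero)          zero    (suc d) = refl
tₛ≈genFun[1] (suc zero)          (suc a) d       = refl
tₛ≈genFun[1] (suc (suc n))       a       d       =
  cong ℤ.+_ (sym (countB-none (perms (suc (suc n)))
                 (λ {π} π∈ → cong (_∧ ((asc π ≡ᵇ a) ∧ (des π ≡ᵇ d))) (==-false (≢[1] π∈)))))
  where
  ≢[1] : ∀ {π} → π ∈ perms (suc (suc n)) → π ≢ 1 ∷ []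
  ≢[1] π∈ refl = contradiction (ℕ.suc-injective (∈perms⇒length {suc (suc n)} π∈)) λ ()

irreducible-split : ∀ π → 𝟙 (isSeparable π ∧ isIrreducible π)
                       ≡ 𝟙 (π == (1 ∷ [])) + 𝟙 (isSeparable π ∧ not (isIrreducible (reverse π)))
irreducible-split π with T? (isSeparable π)
... | no ¬sep rewrite ¬T⇒≡false ¬sep | ==-false {π} {1 ∷ []} (λ { refl → ¬sep _ }) = refl
... | yes sep with isSeparable⇒Separable π sep
...   | one = refl
...   | direct {α} {β} a b
  rewrite T⇒≡true sep
        | ¬T⇒≡false (Reducible⇒¬irreducible (⊕-Reducible a b))
        | ==-false (Reducible⇒≢[1] (⊕-Reducible a b))
        | T⇒≡true (¬Reducible⇒irreducible {reverse (α ⊕ β)} (reverse-⊕-irreducible a b))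
  = refl
...   | skew {α} {β} a b
  rewrite T⇒≡true sep
        | T⇒≡true (¬Reducible⇒irreducible {α ⊖ β} (⊖-irreducible a b))
        | ==-false {α ⊖ β} {1 ∷ []} (Reducible⇒≢[1] (reverse-⊖-Reducible a b) ∘ cong reverse)
        | ¬T⇒≡false (Reducible⇒¬irreducible (reverse-⊖-Reducible a b))
  = refl

R : Series
R = genFun (λ π → isSeparable π ∧ not (isIrreducible π))

S≈I+R : S ≈ I +ₛ R
S≈I+R = genFun-split isSeparable (λ π → isSeparable π ∧ isIrreducible π) (λ π → isSeparable π ∧ not (isIrreducible π))
  (λ π → 𝟙-split (isSeparable π) (isIrreducible π))

mirror : Series → Series
mirror F n a d = F n d a

mirror-cong : ∀ {F G} → F ≈ G → mirror F ≈ mirror G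
mirror-cong F≈G n a d = F≈G n d a

mirror-*ₛ : ∀ F G → mirror (F *ₛ G) ≈ mirror F *ₛ mirror G
mirror-*ₛ F G n a d = Σ≤-cong n (λ i → Σ≤-comm d a (λ j k → F i j k ℤ.* G (n ∸ i) (d ∸ j) (a ∸ k)))

mirror-mono : ∀ i j k → mirror (mono i j k) ≈ mono i k j
mirror-mono i j k n a d = cong (λ b → if (n ≡ᵇ i) ∧ b then ℤ.1ℤ else ℤ.0ℤ) (∧-comm (d ≡ᵇ j) (a ≡ᵇ k))

genFun-mirror : ∀ P → mirror (genFun P) ≈ genFun (P ∘ reverse)
genFun-mirror P n a d = cong ℤ.+_ (countB-bijection source target reverse (unique-perms n) (unique-perms n)
  (λ {y} y∈ t → reverse-∈perms {n} y∈ , subst T (sym (source∘reverse y)) t)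
  (λ {x} x∈ s → reverse x , reverse-∈perms {n} x∈
              , subst T (trans (sym (cong source (List.reverse-involutive x))) (source∘reverse (reverse x))) s
              , List.reverse-involutive x)
  (λ _ _ _ _ → List.reverse-injective))
  where
  source target : List ℕ → Bool
  source π = P π ∧ (asc π ≡ᵇ d) ∧ (des π ≡ᵇ a)
  target π = P (reverse π) ∧ (asc π ≡ᵇ a) ∧ (des π ≡ᵇ d)
  source∘reverse : ∀ π → source (reverse π) ≡ target π
  source∘reverse π rewrite asc-reverse π | des-reverse π = cong (P (reverse π) ∧_) (∧-comm (des π ≡ᵇ d) (asc π ≡ᵇ a))

mirrorS≈S : mirror S ≈ S
mirrorS≈S =
  SeriesRing.trans (genFun-mirror isSeparable) (genFun-cong (isSeparable ∘ reverse) isSeparable isSeparable-reverse)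

I≈t+mirrorR : I ≈ tₛ +ₛ mirror R
I≈t+mirrorR = begin
  I ≈⟨ genFun-split (λ π → isSeparable π ∧ isIrreducible π) (_== (1 ∷ []))
                    (λ π → isSeparable π ∧ not (isIrreducible (reverse π))) irreducible-split ⟩
  genFun (_== (1 ∷ [])) +ₛ genFun (λ π → isSeparable π ∧ not (isIrreducible (reverse π)))
    ≈⟨ SeriesRing.+-cong (SeriesRing.sym tₛ≈genFun[1])
         (genFun-cong (λ π → isSeparable π ∧ not (isIrreducible (reverse π)))
                      (λ π → isSeparable (reverse π) ∧ not (isIrreducible (reverse π)))
                      (λ π → cong (_∧ not (isIrreducible (reverse π))) (sym (isSeparable-reverse π)))) ⟩
  tₛ +ₛ genFun (λ π → isSeparable (reverse π) ∧ not (isIrreducible (reverse π)))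
    ≈⟨ SeriesRing.+-congˡ {tₛ} (SeriesRing.sym (genFun-mirror (λ π → isSeparable π ∧ not (isIrreducible π)))) ⟩
  tₛ +ₛ mirror R                                                             ∎
  where open import Relation.Binary.Reasoning.Setoid SeriesRing.setoid

splittings : ℕ → ℕ → List (List ℕ × List ℕ)
splittings n zero    = cartesianProduct (perms 0) (perms n)
splittings n (suc k) = splittings n k ++ cartesianProduct (perms (suc k)) (perms (n ∸ suc k))

∈-splittings⁺ : ∀ {n k i α β} → i ≤ k → α ∈ perms i → β ∈ perms (n ∸ i) → (α , β) ∈ splittings n k
∈-splittings⁺ {k = zero}  z≤n α∈ β∈ = ∈.∈-cartesianProduct⁺ α∈ β∈
∈-splittings⁺ {n} {suc k} {i} i≤1+k α∈ β∈ with i ℕ.≟ suc k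
... | yes refl = ∈.∈-++⁺ʳ (splittings n k) (∈.∈-cartesianProduct⁺ α∈ β∈)
... | no  i≢   = ∈.∈-++⁺ˡ (∈-splittings⁺ (ℕ.≤-pred (ℕ.≤∧≢⇒< i≤1+k i≢)) α∈ β∈)

∈-splittings⁻ : ∀ {n k α β} → (α , β) ∈ splittings n k → ∃ λ i → i ≤ k × α ∈ perms i × β ∈ perms (n ∸ i)
∈-splittings⁻ {n} {zero} p∈ = 0 , z≤n , ∈.∈-cartesianProduct⁻ (perms 0) (perms n) p∈
∈-splittings⁻ {n} {suc k} p∈ with ∈.∈-++⁻ (splittings n k) p∈
... | inj₁ p∈ˡ = let i , i≤k , α∈β∈ = ∈-splittings⁻ p∈ˡ in i , ℕ.m≤n⇒m≤1+n i≤k , α∈β∈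
... | inj₂ p∈ʳ = suc k , ℕ.≤-refl , ∈.∈-cartesianProduct⁻ (perms (suc k)) (perms (n ∸ suc k)) p∈ʳ

unique-splittings : ∀ n k → Unique (splittings n k)
unique-splittings n zero    = Unique.cartesianProduct⁺ (unique-perms 0) (unique-perms n)
unique-splittings n (suc k) =
  Unique.++⁺ (unique-splittings n k) (Unique.cartesianProduct⁺ (unique-perms (suc k)) (unique-perms (n ∸ suc k))) disjoint
  where
  disjoint : ∀ {p} → ¬ (p ∈ splittings n k × p ∈ cartesianProduct (perms (suc k)) (perms (n ∸ suc k)))
  disjoint {α , β} (p∈ˡ , p∈ʳ) with i , i≤k , α∈ , _ ← ∈-splittings⁻ p∈ˡ =
    ℕ.<-irrefl refl (subst (_≤ k) (trans (sym (∈perms⇒length {i} α∈))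
                                        (∈perms⇒length {suc k} (proj₁ (∈.∈-cartesianProduct⁻ (perms (suc k)) _ p∈ʳ)))) i≤k)

countB-splittings : ∀ (P : List ℕ × List ℕ → Bool) n k →
                    countB P (splittings n k) ≡ ℕ∑.∑ k (λ i → countB P (cartesianProduct (perms i) (perms (n ∸ i))))
countB-splittings P n zero    = refl
countB-splittings P n (suc k) =
  trans (countB-++ P (splittings n k) _)
        (cong (_+ countB P (cartesianProduct (perms (suc k)) (perms (n ∸ suc k)))) (countB-splittings P n k))

countB-reducible : ∀ n a d →
  countB (λ w → (isSeparable w ∧ not (isIrreducible w)) ∧ ((asc w ≡ᵇ a) ∧ (des w ≡ᵇ d))) (perms n)
  ≡ countB (λ (α , β) → ((isSeparable α ∧ isIrreducible α) ∧ isSeparable β) ∧ ((asc (α ⊕ β) ≡ᵇ a) ∧ (des (α ⊕ β) ≡ᵇ d)))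
           (splittings n n)
countB-reducible n a d =
  countB-bijection reducibleStats decompositionStats (λ (α , β) → α ⊕ β)
                   (unique-perms n) (unique-splittings n n) into onto inj
  where
  stats : List ℕ → Bool
  stats w = (asc w ≡ᵇ a) ∧ (des w ≡ᵇ d)
  reducibleStats : List ℕ → Bool
  reducibleStats w = (isSeparable w ∧ not (isIrreducible w)) ∧ stats w
  decompositionStats : List ℕ × List ℕ → Bool
  decompositionStats (α , β) = ((isSeparable α ∧ isIrreducible α) ∧ isSeparable β) ∧ stats (α ⊕ β)

  into : ∀ {p} → p ∈ splittings n n → T (decompositionStats p) →
         proj₁ p ⊕ proj₂ p ∈ perms n × T (reducibleStats (proj₁ p ⊕ proj₂ p))
  into {α , β} p∈ q
    with sep-α , irr-α , sep-β , stats-αβ ← T-∧⁴ (isSeparable α) (isIrreducible α) (isSeparable β) q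
    with i , i≤n , α∈ , β∈ ← ∈-splittings⁻ p∈ =
    subst (λ m → α ⊕ β ∈ perms m) length≡n (Separable⇒∈perms α⊕β)
    , T-∧³ˡ⁻ (Separable⇒isSeparable α⊕β) (¬T⇒T-not (Reducible⇒¬irreducible (⊕-Reducible sα sβ))) stats-αβ
    where
    sα : Separable α
    sα = isSeparable⇒Separable α sep-α
    sβ : Separable β
    sβ = isSeparable⇒Separable β sep-β
    α⊕β : Separable (α ⊕ β)
    α⊕β = direct sα sβ
    length≡n : length (α ⊕ β) ≡ n
    length≡n = trans (length-⊕ α β) (trans (cong₂ _+_ (∈perms⇒length {i} α∈) (∈perms⇒length {n ∸ i} β∈)) (ℕ.m+[n∸m]≡n i≤n))

  onto : ∀ {w} → w ∈ perms n → T (reducibleStats w) →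
         ∃ λ p → p ∈ splittings n n × T (decompositionStats p) × proj₁ p ⊕ proj₂ p ≡ w
  onto {w} w∈ r
    with sep-w , red-w , stats-w ← T-∧³ˡ (isSeparable w) (not (isIrreducible w)) r
    with α , β , refl , sα , sβ , irr-α
           ← ⊕-decompose (isSeparable⇒Separable w sep-w) (¬irreducible⇒Reducible (T-not⇒¬T red-w)) =
    (α , β) , ∈-splittings⁺ α≤n (Separable⇒∈perms sα) β∈
    , T-∧⁴⁻ (Separable⇒isSeparable sα) irr-α (Separable⇒isSeparable sβ) stats-w , refl
    where
    α+β≡n : length α + length β ≡ n
    α+β≡n = trans (sym (length-⊕ α β)) (∈perms⇒length {n} w∈)
    α≤n : length α ≤ n
    α≤n = subst (length α ≤_) α+β≡n (ℕ.m≤m+n _ _)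
    β∈ : β ∈ perms (n ∸ length α)
    β∈ = subst (λ m → β ∈ perms m) (trans (sym (ℕ.m+n∸m≡n (length α) (length β))) (cong (_∸ length α) α+β≡n))
               (Separable⇒∈perms sβ)

  inj : ∀ {p p′} → p ∈ splittings n n → p′ ∈ splittings n n → T (decompositionStats p) → T (decompositionStats p′) →
        proj₁ p ⊕ proj₂ p ≡ proj₁ p′ ⊕ proj₂ p′ → p ≡ p′
  inj {α , β} {α′ , β′} _ _ q q′ eq
    with sep-α , irr-α , sep-β , _ ← T-∧⁴ (isSeparable α) (isIrreducible α) (isSeparable β) q
    with sep-α′ , irr-α′ , sep-β′ , _ ← T-∧⁴ (isSeparable α′) (isIrreducible α′) (isSeparable β′) q′
    with refl , refl ← ⊕-unique (isSeparable⇒Separable α sep-α) (isSeparable⇒Separable β sep-β)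
                                (isSeparable⇒Separable α′ sep-α′) (isSeparable⇒Separable β′ sep-β′) irr-α irr-α′ eq = refl

decomposition-stats : ∀ a d α β →
  ((isSeparable α ∧ isIrreducible α) ∧ isSeparable β) ∧ ((asc (α ⊕ β) ≡ᵇ a) ∧ (des (α ⊕ β) ≡ᵇ d))
  ≡ ((isSeparable α ∧ isIrreducible α) ∧ isSeparable β) ∧ ((suc (asc α) + asc β ≡ᵇ a) ∧ (des α + des β ≡ᵇ d))
decomposition-stats a d α β with T? (isSeparable α) | T? (isSeparable β)
... | yes sep-α | yes sep-β
  rewrite asc-⊕ (isSeparable⇒Separable α sep-α) (isSeparable⇒Separable β sep-β)
        | des-⊕ (isSeparable⇒Separable α sep-α) (isSeparable⇒Separable β sep-β) = refl
... | no ¬sep-α | _ rewrite ¬T⇒≡false ¬sep-α = refl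
... | yes _ | no ¬sep-β rewrite ¬T⇒≡false ¬sep-β =
  trans (cong (_∧ ((asc (α ⊕ β) ≡ᵇ a) ∧ (des (α ⊕ β) ≡ᵇ d))) (∧-zeroʳ (isSeparable α ∧ isIrreducible α)))
        (cong (_∧ ((suc (asc α) + asc β ≡ᵇ a) ∧ (des α + des β ≡ᵇ d))) (sym (∧-zeroʳ (isSeparable α ∧ isIrreducible α))))

pₛ*ₛ-zero : ∀ F n d → (pₛ *ₛ F) n zero d ≡ ℤ.0ℤ
pₛ*ₛ-zero F n d = Σ≤-zero n λ {i} _ → Σ≤-zero d λ {k} _ → no-p i k
  where
  no-p : ∀ i k → mono 0 1 0 i 0 k ℤ.* F (n ∸ i) 0 (d ∸ k) ≡ ℤ.0ℤ
  no-p zero    k = refl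
  no-p (suc i) k = refl

pₛ*ₛ-suc : ∀ F n a d → (pₛ *ₛ F) n (suc a) d ≡ F n a d
pₛ*ₛ-suc F n a d = begin
  Σ≤ n (λ i → Σ≤ (suc a) (λ j → Σ≤ d (λ k → mono 0 1 0 i j k ℤ.* F (n ∸ i) (suc a ∸ j) (d ∸ k))))
    ≡⟨ Σ≤-single n z≤n (λ { {zero} _ 0≢0 → contradiction refl 0≢0
                          ; {suc i} _ _ → Σ≤-zero (suc a) λ _ → Σ≤-zero d λ _ → refl }) ⟩
  Σ≤ (suc a) (λ j → Σ≤ d (λ k → mono 0 1 0 0 j k ℤ.* F n (suc a ∸ j) (d ∸ k)))
    ≡⟨ Σ≤-single (suc a) (s≤s z≤n) (λ { {zero} _ _ → Σ≤-zero d λ _ → refl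
                                      ; {suc zero} _ 1≢1 → contradiction refl 1≢1
                                      ; {suc (suc j)} _ _ → Σ≤-zero d λ _ → refl }) ⟩
  Σ≤ d (λ k → mono 0 1 0 0 1 k ℤ.* F n a (d ∸ k))
    ≡⟨ Σ≤-single d z≤n (λ { {zero} _ 0≢0 → contradiction refl 0≢0 ; {suc k} _ _ → refl }) ⟩
  ℤ.1ℤ ℤ.* F n a d
    ≡⟨ ℤₚ.*-identityˡ _ ⟩
  F n a d ∎
  where open ≡-Reasoning

pₛ*ₛI-count : ∀ i j k → ℤ.+ countB (λ x → (isSeparable x ∧ isIrreducible x) ∧ ((suc (asc x) ≡ᵇ j) ∧ (des x ≡ᵇ k))) (perms i)
                 ≡ (pₛ *ₛ I) i j k
pₛ*ₛI-count i zero    k = trans (cong ℤ.+_ (countB-none (perms i) λ _ → ∧-zeroʳ _)) (sym (pₛ*ₛ-zero I i k))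
pₛ*ₛI-count i (suc j) k = sym (pₛ*ₛ-suc I i j k)

R≈pIS : R ≈ pₛ *ₛ I *ₛ S
R≈pIS n a d = begin
  ℤ.+ countB (λ w → (isSeparable w ∧ not (isIrreducible w)) ∧ ((asc w ≡ᵇ a) ∧ (des w ≡ᵇ d))) (perms n)
    ≡⟨ cong ℤ.+_ (countB-reducible n a d) ⟩
  ℤ.+ countB (λ (α , β) → ((isSeparable α ∧ isIrreducible α) ∧ isSeparable β) ∧ ((asc (α ⊕ β) ≡ᵇ a) ∧ (des (α ⊕ β) ≡ᵇ d)))
           (splittings n n)
    ≡⟨ cong ℤ.+_ (countB-cong (λ (α , β) → decomposition-stats a d α β) (splittings n n)) ⟩
  ℤ.+ countB splitTest (splittings n n)
    ≡⟨ cong ℤ.+_ (countB-splittings splitTest n n) ⟩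
  ℤ.+ ℕ∑.∑ n (λ i → countB splitTest (cartesianProduct (perms i) (perms (n ∸ i))))
    ≡⟨ cong ℤ.+_ (ℕ∑.∑-cong n λ {i} _ → countB-cartesianProduct (λ α → isSeparable α ∧ isIrreducible α) (suc ∘ asc) des
                                                             isSeparable asc des a d (perms i) (perms (n ∸ i))) ⟩
  ℤ.+ ℕ∑.∑ n (λ i → ℕ∑.∑ a λ j → ℕ∑.∑ d λ k → irreducibleCount i j k * separableCount (n ∸ i) (a ∸ j) (d ∸ k))
    ≡⟨ trans (pos-∑ n _) (Σ≤-cong n λ i → trans (pos-∑ a _) (Σ≤-cong a λ j → trans (pos-∑ d _) (Σ≤-cong d λ k →
         trans (ℤₚ.pos-* (irreducibleCount i j k) _) (cong (ℤ._* S (n ∸ i) (a ∸ j) (d ∸ k)) (pₛ*ₛI-count i j k))))) ⟩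
  (pₛ *ₛ I *ₛ S) n a d ∎
  where
  open ≡-Reasoning
  splitTest : List ℕ × List ℕ → Bool
  splitTest (α , β) =
    ((isSeparable α ∧ isIrreducible α) ∧ isSeparable β) ∧ ((suc (asc α) + asc β ≡ᵇ a) ∧ (des α + des β ≡ᵇ d))
  irreducibleCount : ℕ → ℕ → ℕ → ℕ
  irreducibleCount i j k = countB (λ x → (isSeparable x ∧ isIrreducible x) ∧ ((suc (asc x) ≡ᵇ j) ∧ (des x ≡ᵇ k))) (perms i)
  separableCount : ℕ → ℕ → ℕ → ℕ
  separableCount m j k = countB (λ y → isSeparable y ∧ ((asc y ≡ᵇ j) ∧ (des y ≡ᵇ k))) (perms m)

mirrorR≈qJS : mirror R ≈ qₛ *ₛ mirror I *ₛ S
mirrorR≈qJS = begin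
  mirror R                        ≈⟨ mirror-cong R≈pIS ⟩
  mirror (pₛ *ₛ I *ₛ S)           ≈⟨ mirror-*ₛ (pₛ *ₛ I) S ⟩
  mirror (pₛ *ₛ I) *ₛ mirror S    ≈⟨ *-cong (mirror-*ₛ pₛ I) mirrorS≈S ⟩
  mirror pₛ *ₛ mirror I *ₛ S      ≈⟨ *-congʳ {S} (*-congʳ {mirror I} (mirror-mono 0 1 0)) ⟩
  qₛ *ₛ mirror I *ₛ S             ∎
  where
  open SeriesRing using (*-cong; *-congʳ)
  open import Relation.Binary.Reasoning.Setoid SeriesRing.setoid

mirrorI≈t+R : mirror I ≈ tₛ +ₛ R
mirrorI≈t+R n a d = trans (I≈t+mirrorR n d a) (cong (ℤ._+ R n a d) (mirror-mono 1 0 0 n a d))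

open Elimination.FromRelations seriesRing S I R (mirror R) (mirror I) pₛ qₛ tₛ S≈I+R R≈pIS I≈t+mirrorR mirrorR≈qJS mirrorI≈t+R
  using (S-cubic; I-formula)

theorem2 : ((pₛ *ₛ qₛ *ₛ S *ₛ S *ₛ S) +ₛ (pₛ *ₛ qₛ *ₛ tₛ *ₛ S *ₛ S) +ₛ (S *ₛ (((pₛ +ₛ qₛ) *ₛ tₛ) -ₛ 1ₛ)) +ₛ tₛ ≈ 0ₛ)
    × (I *ₛ (1ₛ +ₛ (qₛ *ₛ S)) ≈ tₛ +ₛ (qₛ *ₛ (tₛ +ₛ S) *ₛ S))
theorem2 = S-cubic , I-formula
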